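{- For all positive integers $r,n$, the following identity holds in $\mathbb{Z}[[z_0,\ldots,z_n]]$: \[ \sum_{ k \ge 0 } \prod_{ j=1 }^n [k+1]_{ z_j } \, z_0^k \ = \ \sum_{ (\pi,\epsilon)\in \mathbb{Z}_r\wr S_n } \frac{ \displaystyle \prod_{\substack{j\in \mathrm{Des}(\pi) \\ a_j^\epsilon=0 }}z_0^rz_{\pi(1)}^rz_{\pi(2)}^r\cdots z_{\pi(j)}^r \prod_{j=1}^nz_0^{a_j^\epsilon}z_{\pi(1)}^{a_j^\epsilon}z_{\pi(2)}^{a_j^\epsilon}\cdots z_{\pi(j)}^{a_j^\epsilon} }{ \displaystyle (1-z_0)\prod_{ j=1 }^n \left( 1 - z_0^r \, z_{\pi(1) }^{r} z_{\pi(2) }^{r} \cdots z_{\pi(j)}^{r} \right) } \, . \]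
   Context: $[m]_z=1+z+\cdots+z^{m-1}$. For $\pi\in S_n$, $\mathrm{Des}(\pi)=\{j\in[n-1]:\pi(j)>\pi(j+1)\}$. With $\omega=e^{2\pi i/r}$, the wreath product $\mathbb{Z}_r\wr S_n$ is the set of pairs $(\pi,\epsilon)$ with $\pi\in S_n$ and $\epsilon=(\omega^{c_1},\ldots,\omega^{c_n})$, $c_j\in\{0,\ldots,r-1\}$. Set $c_{n+1}:=0$ and define the color changes $a_j^\epsilon=(c_j-c_{j+1})\bmod r\in\{0,\ldots,r-1\}$ for $j\in[n]$. -}

module Defs where

open import Data.Nat as ℕ using (ℕ; zero; suc; _∸_; _<ᵇ_; _≤ᵇ_; _≡ᵇ_)
open import Data.Integer as ℤ using (ℤ; 0ℤ; 1ℤ)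
open import Data.Bool using (Bool; true; false; if_then_else_; _∧_; _∨_; not)
open import Data.List as L using (List; []; _∷_; [_]; map; concatMap; upTo; foldr; filterᵇ; allFin)
open import Data.Bool.ListAction using (any)
open import Data.Vec as V using (Vec; []; _∷_)
open import Data.Fin as F using (Fin; toℕ)
open import Data.Product using (_×_; _,_)
open import Relation.Nullary.Decidable using (does)

-- For Z[[z_0,...,z_n]] we take k = suc n, position 0 = z_0,
-- position (suc i) = z_{i+1}.

Exp : ℕ → Set
Exp k = Vec ℕ k

Series : ℕ → Set
Series k = Exp k → ℤ

splits : ∀ {k} → Exp k → List (Exp k × Exp k)
splits [] = [ ([] , []) ]
splits (x ∷ e) =
  concatMap (λ i → map (λ p → (i ∷ Data.Product.proj₁ p , (x ∸ i) ∷ Data.Product.proj₂ p)) (splits e))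
            (upTo (suc x))

sumℤ : List ℤ → ℤ
sumℤ = foldr ℤ._+_ 0ℤ

_+s_ : ∀ {k} → Series k → Series k → Series k
(f +s g) e = f e ℤ.+ g e

_*s_ : ∀ {k} → Series k → Series k → Series k
(f *s g) e = sumℤ (map (λ p → f (Data.Product.proj₁ p) ℤ.* g (Data.Product.proj₂ p)) (splits e))

0s : ∀ {k} → Series k
0s _ = 0ℤ

Σs : ∀ {k} {A : Set} → List A → (A → Series k) → Series k
Σs xs f = foldr (λ x acc → f x +s acc) 0s (map (λ x → x) xs)

expEq : ∀ {k} → Exp k → Exp k → Bool
expEq [] [] = true
expEq (x ∷ e) (y ∷ d) = (x ≡ᵇ y) ∧ expEq e d

mono : ∀ {k} → Exp k → Series k
mono m e = if expEq m e then 1ℤ else 0ℤ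

1s : ∀ {k} → Series k
1s {k} = mono (V.replicate k 0)

Πs : ∀ {k} {A : Set} → List A → (A → Series k) → Series k
Πs xs f = foldr (λ x acc → f x *s acc) 1s xs

scale : ∀ {k} → ℕ → Exp k → Exp k
scale t m = V.map (t ℕ.*_) m

unit : ∀ {k} → Fin k → Exp k
unit p = V.tabulate (λ i → if does (i F.≟ p) then 1 else 0)

-- 1/(1 - z^m) = Σ_{t ≥ 0} z^{t·m}, for m ≠ 0.  The coefficient of z^e is 1 iff
-- e = t·m for some t; such t satisfies t ≤ |e| when m ≠ 0.
geom : ∀ {k} → Exp k → Series k
geom m e = if any (λ t → expEq (scale t m) e) (upTo (suc (V.sum e))) then 1ℤ else 0ℤ

qint : ∀ {k} → Fin k → ℕ → Series k
qint p m = Σs (upTo m) (λ i → mono (scale i (unit p)))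

lhsTerm : (n : ℕ) → ℕ → Series (suc n)
lhsTerm n k = Πs (allFin n) (λ j → qint (F.suc j) (suc k)) *s mono (scale k (unit F.zero))

-- The infinite sum over k: since the k-th term is divisible by z_0^k,
-- only k ≤ e_0 contribute to the coefficient of z^e.
lhs : (n : ℕ) → Series (suc n)
lhs n e = Σs (upTo (suc (V.head e))) (lhsTerm n) e

allVecs : (m n : ℕ) → List (Vec (Fin m) n)
allVecs m zero = [ [] ]
allVecs m (suc n) = concatMap (λ x → map (x ∷_) (allVecs m n)) (allFin m)

distinct : List ℕ → Bool
distinct [] = true
distinct (x ∷ xs) = not (any (x ≡ᵇ_) xs) ∧ distinct xs

-- S_n as the one-line notations (π(1),...,π(n)) (0-based values) that are injective
perms : (n : ℕ) → List (Vec (Fin n) n)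
perms n = filterᵇ (λ v → distinct (map toℕ (V.toList v))) (allVecs n n)

wreath : (r n : ℕ) → List (Vec (Fin n) n × Vec (Fin r) n)
wreath r n = concatMap (λ π → map (π ,_) (allVecs r n)) (perms n)

nth : List ℕ → ℕ → ℕ
nth [] _ = 0
nth (x ∷ xs) zero = x
nth (x ∷ xs) (suc i) = nth xs i

module _ (r n : ℕ) (π : Vec (Fin n) n) (c : Vec (Fin r) n) where
  -- indices j below are 0-based: index j stands for the paper's j+1
  πL : List ℕ
  πL = map toℕ (V.toList π)

  cL : List ℕ
  cL = map toℕ (V.toList c)

  -- exponent vector of z_0 z_{π(1)} ... z_{π(j+1)}
  M : ℕ → Exp (suc n)
  M j = 1 ∷ V.tabulate (λ i → if any (λ t → nth πL t ≡ᵇ toℕ i) (upTo (suc j)) then 1 else 0)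

  -- a_{j+1} = (c_{j+1} - c_{j+2}) mod r, with c_{n+1} = 0 (nth defaults to 0)
  a : ℕ → ℕ
  a j = if nth cL (suc j) ≤ᵇ nth cL j
          then nth cL j ∸ nth cL (suc j)
          else (r ℕ.+ nth cL j) ∸ nth cL (suc j)

  isDes : ℕ → Bool
  isDes j = (suc j <ᵇ n) ∧ (nth πL (suc j) <ᵇ nth πL j)

  numerator : Series (suc n)
  numerator =
    Πs (upTo n) (λ j → if isDes j ∧ (a j ≡ᵇ 0) then mono (scale r (M j)) else 1s)
    *s Πs (upTo n) (λ j → mono (scale (a j) (M j)))

  invDenominator : Series (suc n)
  invDenominator = geom (unit F.zero) *s Πs (upTo n) (λ j → geom (scale r (M j)))

  wreathTerm : Series (suc n)
  wreathTerm = numerator *s invDenominator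

rhs : (r n : ℕ) → Series (suc n)
rhs r n = Σs (wreath r n) (λ p → wreathTerm r n (Data.Product.proj₁ p) (Data.Product.proj₂ p))

-- A coefficient of either side is a count. On the left, z^e occurs (once) iff
-- e_i ≤ e_0 for all i ≥ 1, i.e. iff e lies in the cone C = {e : e_i ≤ e_0}. On the
-- right, the (π, ε)-term is the sum of the monomials with exponent
-- N(π,ε) + t·u_0 + Σ_j s_j·r·M_j over t, s_1, …, s_n ≥ 0, where
-- M_j = u_0 + u_{π(1)} + … + u_{π(j)} and N(π,ε) comes from the numerator. Each
-- e ∈ C arises from exactly one (π, ε, t, s), and no e outside C arises at all:
-- π lists z_1, …, z_n by decreasing exponent (ties by increasing index), so that
-- e = t·u_0 + Σ_j d_j·M_j with d_j = e_{π(j)} − e_{π(j+1)} ≥ 0 (e_{π(n+1)} := 0)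
-- and t = e_0 − e_{π(1)}; the colour changes are forced to be a_j = d_j mod r,
-- which determines ε since c_{n+1} = 0; and s_j = ⌊d_j / r⌋, lowered by one at
-- descents with a_j = 0, where the tie-breaking forces d_j > 0 and the numerator
-- supplies the missing r·M_j. Hence both coefficients equal [e ∈ C].

module Submission where

open import Defs
open import Data.Nat as ℕ using (ℕ; zero; suc; _∸_; _≤_; _<_; z≤n; s≤s; _+_; _*_; _≡ᵇ_; _<ᵇ_; _≤ᵇ_; NonZero)
import Data.Nat.Properties as ℕP
open import Data.Nat.DivMod using (_%_; _/_; m<n⇒m%n≡m; [m+n]%n≡m%n; [m+kn]%n≡m%n; m%n<n; m≡m%n+[m/n]*n; m/n≤m; +-distrib-/; m<n⇒m/n≡0; m*n/n≡m; m*n%n≡0)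
open import Data.Nat.Tactic.RingSolver using (solve-∀)
open import Data.Integer as ℤ using (ℤ; 0ℤ; 1ℤ)
import Data.Integer.Properties as ℤP
open import Data.List as L using (List; []; _∷_; [_]; map; concatMap; upTo; foldr; filterᵇ; allFin; _++_; applyUpTo; _∷ʳ_)
import Data.List.Properties as LP
open import Data.List.Relation.Unary.All as All using (All; []; _∷_)
import Data.List.Relation.Unary.All.Properties as AllP
open import Data.List.Relation.Unary.Any as Any using (Any; here; there)
import Data.List.Relation.Unary.Any.Properties as AnyP
open import Data.List.Membership.Propositional using (_∈_; _∉_; find)
import Data.List.Membership.Propositional.Properties as MP
open import Data.List.Relation.Unary.Unique.Propositional using (Unique)
open import Data.List.Relation.Unary.AllPairs as AP using ([]; _∷_)
import Data.List.Relation.Unary.Unique.Propositional.Properties as UP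
open import Data.Vec as V using (Vec; []; _∷_)
import Data.Vec.Properties as VP
open import Data.Vec.Relation.Unary.All as VA using () renaming (All to VAll)
open import Data.Fin as F using (Fin; toℕ)
import Data.Fin.Properties as FP
open import Data.Product using (Σ; _×_; _,_; proj₁; proj₂)
open import Data.Sum using (_⊎_; inj₁; inj₂)
open import Data.Unit using (⊤; tt)
open import Data.Empty using (⊥; ⊥-elim)
open import Relation.Binary.PropositionalEquality hiding ([_])
open import Relation.Nullary
open import Relation.Nullary.Decidable using (_×-dec_)
open import Relation.Binary.Definitions using (Tri; tri<; tri≈; tri>)
open import Data.Bool using (Bool; true; false; if_then_else_; _∧_; T)
open import Data.Bool.ListAction using (any)
open import Function using (_∘_; id)

import Algebra.Properties.CommutativeSemigroup ℤP.+-commutativeSemigroup as ℤ+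
import Algebra.Properties.CommutativeSemigroup ℕP.+-commutativeSemigroup as ℕ+

private variable
  A B : Set

false≢true : false ≢ true
false≢true ()

T⇒≡ : ∀ {b} → T b → b ≡ true
T⇒≡ {true} _ = refl

¬T⇒≡ : ∀ {b} → ¬ T b → b ≡ false
¬T⇒≡ {true} nt = ⊥-elim (nt tt)
¬T⇒≡ {false} _ = refl

≡⇒T : ∀ {b} → b ≡ true → T b
≡⇒T refl = tt

≡ᵇ-refl : ∀ x → (x ≡ᵇ x) ≡ true
≡ᵇ-refl x = T⇒≡ (ℕP.≡⇒≡ᵇ x x refl)

≡ᵇ≡true⇒≡ : ∀ {m n} → (m ≡ᵇ n) ≡ true → m ≡ n
≡ᵇ≡true⇒≡ {m} {n} e = ℕP.≡ᵇ⇒≡ m n (≡⇒T e)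

≤⇒≤ᵇ≡true : ∀ {m n} → m ≤ n → (m ≤ᵇ n) ≡ true
≤⇒≤ᵇ≡true le = T⇒≡ (ℕP.≤⇒≤ᵇ le)

≰⇒≤ᵇ≡false : ∀ {m n} → ¬ m ≤ n → (m ≤ᵇ n) ≡ false
≰⇒≤ᵇ≡false {m} {n} nle = ¬T⇒≡ (λ t → nle (ℕP.≤ᵇ⇒≤ m n t))

<⇒<ᵇ≡true : ∀ {m n} → m < n → (m <ᵇ n) ≡ true
<⇒<ᵇ≡true le = T⇒≡ (ℕP.<⇒<ᵇ le)

≮⇒<ᵇ≡false : ∀ {m n} → ¬ m < n → (m <ᵇ n) ≡ false
≮⇒<ᵇ≡false {m} {n} nle = ¬T⇒≡ (λ t → nle (ℕP.<ᵇ⇒< m n t))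

<ᵇ≡true⇒< : ∀ {m n} → (m <ᵇ n) ≡ true → m < n
<ᵇ≡true⇒< {m} {n} e = ℕP.<ᵇ⇒< m n (≡⇒T e)

∧-true : ∀ {x y} → x ∧ y ≡ true → x ≡ true × y ≡ true
∧-true {true} {true} _ = refl , refl

any≡true⇒ : (p : A → Bool) (xs : List A) → any p xs ≡ true → Any (λ x → p x ≡ true) xs
any≡true⇒ p xs eq = Any.map T⇒≡ (AnyP.any⁻ p xs (≡⇒T eq))

any≡true⇐ : (p : A → Bool) (xs : List A) → Any (λ x → p x ≡ true) xs → any p xs ≡ true
any≡true⇐ p xs a = T⇒≡ (AnyP.any⁺ p (Any.map ≡⇒T a))

∑ : List A → (A → ℤ) → ℤ
∑ xs f = sumℤ (map f xs)

∑-++ : ∀ (xs ys : List A) f → ∑ (xs ++ ys) f ≡ ∑ xs f ℤ.+ ∑ ys f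
∑-++ [] ys f = sym (ℤP.+-identityˡ _)
∑-++ (x ∷ xs) ys f rewrite ∑-++ xs ys f = sym (ℤP.+-assoc (f x) _ _)

∑-∷ʳ : ∀ (xs : List A) x f → ∑ (xs ∷ʳ x) f ≡ ∑ xs f ℤ.+ f x
∑-∷ʳ xs x f = trans (∑-++ xs [ x ] f) (cong (λ z → ∑ xs f ℤ.+ z) (ℤP.+-identityʳ (f x)))

∑-cong : ∀ (xs : List A) {f g} → (∀ x → f x ≡ g x) → ∑ xs f ≡ ∑ xs g
∑-cong [] eq = refl
∑-cong (x ∷ xs) eq = cong₂ ℤ._+_ (eq x) (∑-cong xs eq)

∑-cong-All : ∀ {xs : List A} {f g} → All (λ x → f x ≡ g x) xs → ∑ xs f ≡ ∑ xs g
∑-cong-All [] = refl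
∑-cong-All (p ∷ ps) = cong₂ ℤ._+_ p (∑-cong-All ps)

∑-*ˡ : ∀ (xs : List A) c f → c ℤ.* ∑ xs f ≡ ∑ xs (λ x → c ℤ.* f x)
∑-*ˡ [] c f = ℤP.*-zeroʳ c
∑-*ˡ (x ∷ xs) c f = trans (ℤP.*-distribˡ-+ c (f x) _) (cong (λ z → c ℤ.* f x ℤ.+ z) (∑-*ˡ xs c f))

∑-*ʳ : ∀ (xs : List A) c f → ∑ xs f ℤ.* c ≡ ∑ xs (λ x → f x ℤ.* c)
∑-*ʳ xs c f = trans (ℤP.*-comm _ c) (trans (∑-*ˡ xs c f) (∑-cong xs (λ x → ℤP.*-comm c (f x))))

∑-zero : ∀ (xs : List A) → ∑ xs (λ _ → 0ℤ) ≡ 0ℤ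
∑-zero [] = refl
∑-zero (x ∷ xs) = trans (ℤP.+-identityˡ _) (∑-zero xs)

∑-+ : ∀ (xs : List A) f g → ∑ xs (λ x → f x ℤ.+ g x) ≡ ∑ xs f ℤ.+ ∑ xs g
∑-+ [] f g = refl
∑-+ (x ∷ xs) f g rewrite ∑-+ xs f g = ℤ+.interchange (f x) (g x) (∑ xs f) (∑ xs g)

∑-comm : ∀ (xs : List A) (ys : List B) (f : A → B → ℤ) →
  ∑ xs (λ x → ∑ ys (λ y → f x y)) ≡ ∑ ys (λ y → ∑ xs (λ x → f x y))
∑-comm [] ys f = sym (∑-zero ys)
∑-comm (x ∷ xs) ys f = trans (cong (λ z → ∑ ys (f x) ℤ.+ z) (∑-comm xs ys f)) (sym (∑-+ ys (f x) _))

∑-map : ∀ (g : B → A) (xs : List B) f → ∑ (map g xs) f ≡ ∑ xs (f ∘ g)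
∑-map g [] f = refl
∑-map g (x ∷ xs) f = cong (λ z → f (g x) ℤ.+ z) (∑-map g xs f)

∑-concatMap : ∀ (h : B → List A) (xs : List B) f → ∑ (concatMap h xs) f ≡ ∑ xs (λ x → ∑ (h x) f)
∑-concatMap h [] f = refl
∑-concatMap h (x ∷ xs) f = trans (∑-++ (h x) _ f) (cong (λ z → ∑ (h x) f ℤ.+ z) (∑-concatMap h xs f))

∑-filterᵇ : ∀ (p : A → Bool) (xs : List A) f → ∑ (filterᵇ p xs) f ≡ ∑ xs (λ x → if p x then f x else 0ℤ)
∑-filterᵇ p [] f = refl
∑-filterᵇ p (x ∷ xs) f with p x
... | true = cong (λ z → f x ℤ.+ z) (∑-filterᵇ p xs f)
... | false = trans (∑-filterᵇ p xs f) (sym (ℤP.+-identityˡ _))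

𝟙 : ∀ {P : Set} → Dec P → ℤ
𝟙 (yes _) = 1ℤ
𝟙 (no _) = 0ℤ

𝟙-cong : ∀ {P Q : Set} (d : Dec P) (d' : Dec Q) → (P → Q) → (Q → P) → 𝟙 d ≡ 𝟙 d'
𝟙-cong (yes p) (yes q) f g = refl
𝟙-cong (yes p) (no ¬q) f g = ⊥-elim (¬q (f p))
𝟙-cong (no ¬p) (yes q) f g = ⊥-elim (¬p (g q))
𝟙-cong (no _) (no _) f g = refl

𝟙-× : ∀ {P Q : Set} (d : Dec P) (d' : Dec Q) → 𝟙 (d ×-dec d') ≡ 𝟙 d ℤ.* 𝟙 d'
𝟙-× (yes p) (yes q) = refl
𝟙-× (yes p) (no _) = refl
𝟙-× (no _) (yes q) = refl
𝟙-× (no _) (no _) = refl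

𝟙-yes : ∀ {P : Set} (d : Dec P) → P → 𝟙 d ≡ 1ℤ
𝟙-yes (yes _) p = refl
𝟙-yes (no ¬p) p = ⊥-elim (¬p p)

𝟙-no : ∀ {P : Set} (d : Dec P) → ¬ P → 𝟙 d ≡ 0ℤ
𝟙-no (yes p) ¬p = ⊥-elim (¬p p)
𝟙-no (no _) _ = refl

𝟙-sym : ∀ (x y : ℕ) → 𝟙 (x ℕ.≟ y) ≡ 𝟙 (y ℕ.≟ x)
𝟙-sym x y = 𝟙-cong (x ℕ.≟ y) (y ℕ.≟ x) sym sym

∑-upTo-𝟙≟ : ∀ m x (G : ℕ → ℤ) → ∑ (upTo m) (λ i → 𝟙 (x ℕ.≟ i) ℤ.* G i) ≡ 𝟙 (x ℕ.<? m) ℤ.* G x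
∑-upTo-𝟙≟ zero x G = refl
∑-upTo-𝟙≟ (suc m) x G = begin
    ∑ (upTo (suc m)) h
  ≡⟨ cong (λ l → ∑ l h) (sym (LP.upTo-∷ʳ m)) ⟩
    ∑ (upTo m ∷ʳ m) h
  ≡⟨ ∑-∷ʳ (upTo m) m h ⟩
    ∑ (upTo m) h ℤ.+ h m
  ≡⟨ cong (ℤ._+ h m) (∑-upTo-𝟙≟ m x G) ⟩
    𝟙 (x ℕ.<? m) ℤ.* G x ℤ.+ 𝟙 (x ℕ.≟ m) ℤ.* G m
  ≡⟨ last (ℕP.<-cmp x m) ⟩
    𝟙 (x ℕ.<? suc m) ℤ.* G x ∎
  where
  open ≡-Reasoning
  h = λ i → 𝟙 (x ℕ.≟ i) ℤ.* G i
  last : Tri (x < m) (x ≡ m) (m < x) → 𝟙 (x ℕ.<? m) ℤ.* G x ℤ.+ 𝟙 (x ℕ.≟ m) ℤ.* G m ≡ 𝟙 (x ℕ.<? suc m) ℤ.* G x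
  last (tri< x<m x≢m _)
    rewrite 𝟙-yes (x ℕ.<? m) x<m | 𝟙-no (x ℕ.≟ m) x≢m | 𝟙-yes (x ℕ.<? suc m) (ℕP.m<n⇒m<1+n x<m) = ℤP.+-identityʳ _
  last (tri≈ x≮m refl _)
    rewrite 𝟙-no (x ℕ.<? m) x≮m | 𝟙-yes (x ℕ.≟ m) refl | 𝟙-yes (x ℕ.<? suc m) (ℕP.n<1+n x) = ℤP.+-identityˡ _
  last (tri> x≮m x≢m m<x)
    rewrite 𝟙-no (x ℕ.<? m) x≮m | 𝟙-no (x ℕ.≟ m) x≢m | 𝟙-no (x ℕ.<? suc m) (ℕP.<⇒≱ m<x ∘ ℕP.≤-pred) = refl

∑-upTo-𝟙≟-once : ∀ m x → x < m → ∑ (upTo m) (λ t → 𝟙 (t ℕ.≟ x)) ≡ 1ℤ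
∑-upTo-𝟙≟-once m x x<m = begin
    ∑ (upTo m) (λ t → 𝟙 (t ℕ.≟ x))
  ≡⟨ ∑-cong (upTo m) (λ t → trans (𝟙-sym t x) (sym (ℤP.*-identityʳ _))) ⟩
    ∑ (upTo m) (λ t → 𝟙 (x ℕ.≟ t) ℤ.* 1ℤ)
  ≡⟨ ∑-upTo-𝟙≟ m x (λ _ → 1ℤ) ⟩
    𝟙 (x ℕ.<? m) ℤ.* 1ℤ
  ≡⟨ trans (ℤP.*-identityʳ _) (𝟙-yes (x ℕ.<? m) x<m) ⟩
    1ℤ ∎
  where open ≡-Reasoning

infixl 6 _+v_ _∸v_

_+v_ : ∀ {k} → Exp k → Exp k → Exp k
_+v_ = V.zipWith ℕ._+_

_∸v_ : ∀ {k} → Exp k → Exp k → Exp k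
_∸v_ = V.zipWith _∸_

0v : ∀ {k} → Exp k
0v {k} = V.replicate k 0

_≤v_ : ∀ {k} → Exp k → Exp k → Set
[] ≤v [] = ⊤
(x ∷ xs) ≤v (y ∷ ys) = x ≤ y × xs ≤v ys

_≤v?_ : ∀ {k} (a b : Exp k) → Dec (a ≤v b)
[] ≤v? [] = yes tt
(x ∷ xs) ≤v? (y ∷ ys) = (x ℕ.≤? y) ×-dec (xs ≤v? ys)

_≟v_ : ∀ {k} (a b : Exp k) → Dec (a ≡ b)
_≟v_ = VP.≡-dec ℕ._≟_

expEq-refl : ∀ {k} (a : Exp k) → expEq a a ≡ true
expEq-refl [] = refl
expEq-refl (x ∷ a) rewrite ≡ᵇ-refl x = expEq-refl a

expEq⇒≡ : ∀ {k} (a b : Exp k) → expEq a b ≡ true → a ≡ b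
expEq⇒≡ [] [] _ = refl
expEq⇒≡ (x ∷ a) (y ∷ b) eq = cong₂ _∷_ (≡ᵇ≡true⇒≡ (proj₁ (∧-true eq))) (expEq⇒≡ a b (proj₂ (∧-true eq)))

mono-𝟙 : ∀ {k} (m d : Exp k) → mono m d ≡ 𝟙 (m ≟v d)
mono-𝟙 m d with expEq m d in eq | m ≟v d
... | true | yes _ = refl
... | true | no m≢d = ⊥-elim (m≢d (expEq⇒≡ m d eq))
... | false | yes refl = ⊥-elim (false≢true (trans (sym eq) (expEq-refl m)))
... | false | no _ = refl

𝟙-≟v-∷ : ∀ {k} x y (xs ys : Exp k) → 𝟙 ((x ∷ xs) ≟v (y ∷ ys)) ≡ 𝟙 (x ℕ.≟ y) ℤ.* 𝟙 (xs ≟v ys)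
𝟙-≟v-∷ x y xs ys = trans (𝟙-cong _ (x ℕ.≟ y ×-dec (xs ≟v ys)) (λ { refl → refl , refl }) (λ { (refl , refl) → refl }))
                         (𝟙-× (x ℕ.≟ y) (xs ≟v ys))

∑-splits-𝟙≟ : ∀ {k} (e x : Exp k) (g : Exp k → ℤ) →
  ∑ (splits e) (λ p → 𝟙 (x ≟v proj₁ p) ℤ.* g (proj₂ p)) ≡ 𝟙 (x ≤v? e) ℤ.* g (e ∸v x)
∑-splits-𝟙≟ [] [] g = ℤP.+-identityʳ _
∑-splits-𝟙≟ (y ∷ e) (x₀ ∷ x) g = begin
    ∑ (splits (y ∷ e)) h
  ≡⟨ ∑-concatMap H (upTo (suc y)) h ⟩
    ∑ (upTo (suc y)) (λ i → ∑ (H i) h)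
  ≡⟨ ∑-cong (upTo (suc y)) (λ i → trans (∑-map _ (splits e) h) (headSplit i)) ⟩
    ∑ (upTo (suc y)) (λ i → 𝟙 (x₀ ℕ.≟ i) ℤ.* (𝟙 (x ≤v? e) ℤ.* g ((y ∸ i) ∷ (e ∸v x))))
  ≡⟨ ∑-upTo-𝟙≟ (suc y) x₀ (λ i → 𝟙 (x ≤v? e) ℤ.* g ((y ∸ i) ∷ (e ∸v x))) ⟩
    𝟙 (x₀ ℕ.<? suc y) ℤ.* (𝟙 (x ≤v? e) ℤ.* g ((y ∸ x₀) ∷ (e ∸v x)))
  ≡⟨ sym (ℤP.*-assoc (𝟙 (x₀ ℕ.<? suc y)) (𝟙 (x ≤v? e)) _) ⟩
    𝟙 (x₀ ℕ.<? suc y) ℤ.* 𝟙 (x ≤v? e) ℤ.* g ((y ∸ x₀) ∷ (e ∸v x))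
  ≡⟨ cong (λ z → z ℤ.* 𝟙 (x ≤v? e) ℤ.* g ((y ∸ x₀) ∷ (e ∸v x))) (𝟙-cong (x₀ ℕ.<? suc y) (x₀ ℕ.≤? y) ℕP.≤-pred s≤s) ⟩
    𝟙 (x₀ ℕ.≤? y) ℤ.* 𝟙 (x ≤v? e) ℤ.* g ((y ∸ x₀) ∷ (e ∸v x))
  ≡⟨ cong (ℤ._* g ((y ∸ x₀) ∷ (e ∸v x))) (sym (𝟙-× (x₀ ℕ.≤? y) (x ≤v? e))) ⟩
    𝟙 ((x₀ ∷ x) ≤v? (y ∷ e)) ℤ.* g ((y ∸ x₀) ∷ (e ∸v x)) ∎
  where
  open ≡-Reasoning
  h = λ (p : Exp _ × Exp _) → 𝟙 ((x₀ ∷ x) ≟v proj₁ p) ℤ.* g (proj₂ p)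
  H = λ i → map (λ p → (i ∷ proj₁ p , (y ∸ i) ∷ proj₂ p)) (splits e)
  headSplit : ∀ i → ∑ (splits e) (λ p → h (i ∷ proj₁ p , (y ∸ i) ∷ proj₂ p))
                    ≡ 𝟙 (x₀ ℕ.≟ i) ℤ.* (𝟙 (x ≤v? e) ℤ.* g ((y ∸ i) ∷ (e ∸v x)))
  headSplit i = begin
      ∑ (splits e) (λ p → h (i ∷ proj₁ p , (y ∸ i) ∷ proj₂ p))
    ≡⟨ ∑-cong (splits e) (λ p → trans (cong (ℤ._* g ((y ∸ i) ∷ proj₂ p)) (𝟙-≟v-∷ x₀ i x (proj₁ p)))
                                      (ℤP.*-assoc (𝟙 (x₀ ℕ.≟ i)) (𝟙 (x ≟v proj₁ p)) _)) ⟩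
      ∑ (splits e) (λ p → 𝟙 (x₀ ℕ.≟ i) ℤ.* (𝟙 (x ≟v proj₁ p) ℤ.* g ((y ∸ i) ∷ proj₂ p)))
    ≡⟨ sym (∑-*ˡ (splits e) (𝟙 (x₀ ℕ.≟ i)) _) ⟩
      𝟙 (x₀ ℕ.≟ i) ℤ.* ∑ (splits e) (λ p → 𝟙 (x ≟v proj₁ p) ℤ.* g ((y ∸ i) ∷ proj₂ p))
    ≡⟨ cong (𝟙 (x₀ ℕ.≟ i) ℤ.*_) (∑-splits-𝟙≟ e x (λ d → g ((y ∸ i) ∷ d))) ⟩
      𝟙 (x₀ ℕ.≟ i) ℤ.* (𝟙 (x ≤v? e) ℤ.* g ((y ∸ i) ∷ (e ∸v x))) ∎

splits-sum-≤ : ∀ {k} (e : Exp k) → All (λ p → V.sum (proj₁ p) ≤ V.sum e) (splits e)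
splits-sum-≤ [] = z≤n ∷ []
splits-sum-≤ (y ∷ e) = AllP.concat⁺ (AllP.map⁺ (AllP.applyUpTo⁺₁ id (suc y) (λ {i} i<sy →
  AllP.map⁺ (All.map (ℕP.+-mono-≤ (ℕP.≤-pred i<sy)) (splits-sum-≤ e)))))

sum-∸v-≤ : ∀ {k} (y x : Exp k) → V.sum (y ∸v x) ≤ V.sum y
sum-∸v-≤ [] [] = z≤n
sum-∸v-≤ (a ∷ y) (b ∷ x) = ℕP.+-mono-≤ (ℕP.m∸n≤m a b) (sum-∸v-≤ y x)

≤v∧∸v⇒+v : ∀ {k} (x x' y : Exp k) → x ≤v y × x' ≡ y ∸v x → x +v x' ≡ y
≤v∧∸v⇒+v [] [] [] _ = refl
≤v∧∸v⇒+v (a ∷ x) (b ∷ x') (c ∷ y) ((a≤c , rest) , eq) with VP.∷-injective eq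
... | refl , eq' = cong₂ _∷_ (ℕP.m+[n∸m]≡n a≤c) (≤v∧∸v⇒+v x x' y (rest , eq'))

+v⇒≤v∧∸v : ∀ {k} (x x' y : Exp k) → x +v x' ≡ y → x ≤v y × x' ≡ y ∸v x
+v⇒≤v∧∸v [] [] [] _ = tt , refl
+v⇒≤v∧∸v (a ∷ x) (b ∷ x') (c ∷ y) eq with VP.∷-injective eq
... | refl , eq' with +v⇒≤v∧∸v x x' y eq'
... | le , eq'' = (ℕP.m≤m+n a b , le) , cong₂ _∷_ (sym (ℕP.m+n∸m≡n a b)) eq''

𝟙-≤v-∸v : ∀ {k} (x x' y : Exp k) → 𝟙 (x ≤v? y) ℤ.* 𝟙 (x' ≟v (y ∸v x)) ≡ 𝟙 ((x +v x') ≟v y)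
𝟙-≤v-∸v x x' y = trans (sym (𝟙-× (x ≤v? y) (x' ≟v (y ∸v x)))) (𝟙-cong _ _ (≤v∧∸v⇒+v x x' y) (+v⇒≤v∧∸v x x' y))

count : ∀ {k} → List (Exp k) → Exp k → ℤ
count L d = ∑ L (λ x → 𝟙 (x ≟v d))

Counts : ∀ {k} → ℕ → Series k → List (Exp k) → Set
Counts S f L = ∀ d → V.sum d ≤ S → f d ≡ count L d

pairwiseSums : ∀ {k} → List (Exp k) → List (Exp k) → List (Exp k)
pairwiseSums L L' = concatMap (λ x → map (x +v_) L') L

∑-pairwiseSums : ∀ {k} (L L' : List (Exp k)) h → ∑ (pairwiseSums L L') h ≡ ∑ L (λ x → ∑ L' (λ x' → h (x +v x')))
∑-pairwiseSums L L' h = trans (∑-concatMap _ L h) (∑-cong L (λ x → ∑-map (x +v_) L' h))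

*s-expandˡ : ∀ {k S} {f g : Series k} {L} → Counts S f L → ∀ y → V.sum y ≤ S →
  (f *s g) y ≡ ∑ L (λ x → 𝟙 (x ≤v? y) ℤ.* g (y ∸v x))
*s-expandˡ {f = f} {g} {L} counts y le = begin
    ∑ (splits y) (λ p → f (proj₁ p) ℤ.* g (proj₂ p))
  ≡⟨ ∑-cong-All (All.map (λ {p} lp → cong (ℤ._* g (proj₂ p)) (counts (proj₁ p) (ℕP.≤-trans lp le))) (splits-sum-≤ y)) ⟩
    ∑ (splits y) (λ p → count L (proj₁ p) ℤ.* g (proj₂ p))
  ≡⟨ ∑-cong (splits y) (λ p → ∑-*ʳ L (g (proj₂ p)) (λ x → 𝟙 (x ≟v proj₁ p))) ⟩
    ∑ (splits y) (λ p → ∑ L (λ x → 𝟙 (x ≟v proj₁ p) ℤ.* g (proj₂ p)))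
  ≡⟨ ∑-comm (splits y) L (λ p x → 𝟙 (x ≟v proj₁ p) ℤ.* g (proj₂ p)) ⟩
    ∑ L (λ x → ∑ (splits y) (λ p → 𝟙 (x ≟v proj₁ p) ℤ.* g (proj₂ p)))
  ≡⟨ ∑-cong L (λ x → ∑-splits-𝟙≟ y x g) ⟩
    ∑ L (λ x → 𝟙 (x ≤v? y) ℤ.* g (y ∸v x)) ∎
  where open ≡-Reasoning

Counts-*s : ∀ {k S} {f g : Series k} {L L'} → Counts S f L → Counts S g L' → Counts S (f *s g) (pairwiseSums L L')
Counts-*s {f = f} {g} {L} {L'} counts-f counts-g y le = begin
    (f *s g) y
  ≡⟨ *s-expandˡ {f = f} {g = g} {L = L} counts-f y le ⟩
    ∑ L (λ x → 𝟙 (x ≤v? y) ℤ.* g (y ∸v x))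
  ≡⟨ ∑-cong L (λ x → cong (𝟙 (x ≤v? y) ℤ.*_) (counts-g (y ∸v x) (ℕP.≤-trans (sum-∸v-≤ y x) le))) ⟩
    ∑ L (λ x → 𝟙 (x ≤v? y) ℤ.* count L' (y ∸v x))
  ≡⟨ ∑-cong L (λ x → ∑-*ˡ L' (𝟙 (x ≤v? y)) _) ⟩
    ∑ L (λ x → ∑ L' (λ x' → 𝟙 (x ≤v? y) ℤ.* 𝟙 (x' ≟v (y ∸v x))))
  ≡⟨ ∑-cong L (λ x → ∑-cong L' (λ x' → 𝟙-≤v-∸v x x' y)) ⟩
    ∑ L (λ x → ∑ L' (λ x' → 𝟙 ((x +v x') ≟v y)))
  ≡⟨ sym (∑-pairwiseSums L L' (λ z → 𝟙 (z ≟v y))) ⟩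
    count (pairwiseSums L L') y ∎
  where open ≡-Reasoning

Counts-mono : ∀ {k S} (m : Exp k) → Counts S (mono m) [ m ]
Counts-mono m d _ = trans (mono-𝟙 m d) (sym (ℤP.+-identityʳ _))

iteratedSums : ∀ {k} → List A → (A → List (Exp k)) → List (Exp k)
iteratedSums xs L = foldr (λ x acc → pairwiseSums (L x) acc) [ 0v ] xs

Counts-Πs : ∀ {k S} (xs : List A) {f : A → Series k} {L} → (∀ x → Counts S (f x) (L x)) → Counts S (Πs xs f) (iteratedSums xs L)
Counts-Πs [] counts = Counts-mono 0v
Counts-Πs (x ∷ xs) {f} {L} counts =
  Counts-*s {f = f x} {g = Πs xs f} {L = L x} {L' = iteratedSums xs L} (counts x) (Counts-Πs xs {f} {L} counts)

Σs-apply : ∀ {k} (xs : List A) (f : A → Series k) d → Σs xs f d ≡ ∑ xs (λ x → f x d)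
Σs-apply xs f d = trans (cong (λ l → foldr (λ x acc → f x +s acc) 0s l d) (LP.map-id xs)) (go xs)
  where
  go : ∀ xs → foldr (λ x acc → f x +s acc) 0s xs d ≡ ∑ xs (λ x → f x d)
  go [] = refl
  go (x ∷ xs) = cong (λ z → f x d ℤ.+ z) (go xs)

Counts-Σs : ∀ {k S} (xs : List A) {f : A → Series k} {L} → (∀ x → Counts S (f x) (L x)) → Counts S (Σs xs f) (concatMap L xs)
Counts-Σs xs {f} {L} counts d le =
  trans (Σs-apply xs f d) (trans (∑-cong xs (λ x → counts x d le)) (sym (∑-concatMap L xs _)))

head≤sum : ∀ {k} (d : Exp (suc k)) → V.head d ≤ V.sum d
head≤sum (x ∷ d) = ℕP.m≤m+n x _

t≤head-scale : ∀ {k} t (m : Exp (suc k)) → 0 < V.head m → t ≤ V.head (scale t m)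
t≤head-scale t (x ∷ m) (s≤s _) = ℕP.m≤m*n t x

scale-injectiveˡ : ∀ {k} t t' (m : Exp (suc k)) → 0 < V.head m → scale t m ≡ scale t' m → t ≡ t'
scale-injectiveˡ t t' (suc x ∷ m) _ eq = ℕP.*-cancelʳ-≡ t t' (suc x) (cong V.head eq)

-- Positivity of the head coordinate makes t ↦ t·m injective and bounds t by the degree.
Counts-geom : ∀ {k S} (m : Exp (suc k)) → 0 < V.head m → Counts S (geom m) (map (λ t → scale t m) (upTo (suc S)))
Counts-geom {k} {S} m pos d le with any (λ t → expEq (scale t m) d) (upTo (suc (V.sum d))) in eq
... | true = sym (begin
    count (map (λ t → scale t m) (upTo (suc S))) d
  ≡⟨ ∑-map (λ t → scale t m) (upTo (suc S)) (λ x → 𝟙 (x ≟v d)) ⟩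
    ∑ (upTo (suc S)) (λ t' → 𝟙 (scale t' m ≟v d))
  ≡⟨ ∑-cong (upTo (suc S)) (λ t' → trans (𝟙-cong (scale t' m ≟v d) (t ℕ.≟ t')
                                                 (λ e' → scale-injectiveˡ t t' m pos (trans tm≡d (sym e')))
                                                 (λ { refl → tm≡d }))
                                          (sym (ℤP.*-identityʳ _))) ⟩
    ∑ (upTo (suc S)) (λ t' → 𝟙 (t ℕ.≟ t') ℤ.* 1ℤ)
  ≡⟨ ∑-upTo-𝟙≟ (suc S) t (λ _ → 1ℤ) ⟩
    𝟙 (t ℕ.<? suc S) ℤ.* 1ℤ
  ≡⟨ trans (ℤP.*-identityʳ _) (𝟙-yes (t ℕ.<? suc S) (s≤s t≤S)) ⟩
    1ℤ ∎)
  where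
  open ≡-Reasoning
  witness = AnyP.applyUpTo⁻ id (any≡true⇒ _ (upTo (suc (V.sum d))) eq)
  t = proj₁ witness
  tm≡d : scale t m ≡ d
  tm≡d = expEq⇒≡ _ _ (proj₂ (proj₂ witness))
  t≤S : t ≤ S
  t≤S = ℕP.≤-trans (ℕP.≤-pred (proj₁ (proj₂ witness))) le
... | false = sym (trans (∑-map (λ t → scale t m) (upTo (suc S)) (λ x → 𝟙 (x ≟v d)))
                 (trans (∑-cong (upTo (suc S)) (λ t → 𝟙-no (scale t m ≟v d) (notMultiple t))) (∑-zero (upTo (suc S)))))
  where
  notMultiple : ∀ t → scale t m ≢ d
  notMultiple t tm≡d = false≢true (trans (sym eq) (any≡true⇐ _ (upTo (suc (V.sum d)))
    (AnyP.applyUpTo⁺ id {i = t} (trans (cong (λ z → expEq z d) tm≡d) (expEq-refl d))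
      (s≤s (ℕP.≤-trans (t≤head-scale t m pos) (subst (λ z → V.head z ≤ V.sum d) (sym tm≡d) (head≤sum d)))))))

tuples : List ℕ → ℕ → List (List ℕ)
tuples U zero = [ [] ]
tuples U (suc k) = concatMap (λ t → map (t ∷_) (tuples U k)) U

-- Lists of naturals are read as padded with zeros.
hd : List ℕ → ℕ
hd [] = 0
hd (x ∷ _) = x

tl : List ℕ → List ℕ
tl [] = []
tl (_ ∷ xs) = xs

linComb : ∀ {k} (g : A → ℕ → Exp k) → List A → List ℕ → Exp k
linComb g [] ts = 0v
linComb g (j ∷ js) ts = g j (hd ts) +v linComb g js (tl ts)

∑-iteratedSums : ∀ {k} (U : List ℕ) (g : A → ℕ → Exp k) (L : A → List (Exp k)) →
  (∀ j h → ∑ (L j) h ≡ ∑ U (λ t → h (g j t))) →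
  ∀ js h → ∑ (iteratedSums js L) h ≡ ∑ (tuples U (L.length js)) (λ ts → h (linComb g js ts))
∑-iteratedSums U g L hyp [] h = refl
∑-iteratedSums U g L hyp (j ∷ js) h = begin
    ∑ (pairwiseSums (L j) (iteratedSums js L)) h
  ≡⟨ ∑-pairwiseSums (L j) (iteratedSums js L) h ⟩
    ∑ (L j) (λ x → ∑ (iteratedSums js L) (λ y → h (x +v y)))
  ≡⟨ hyp j _ ⟩
    ∑ U (λ t → ∑ (iteratedSums js L) (λ y → h (g j t +v y)))
  ≡⟨ ∑-cong U (λ t → ∑-iteratedSums U g L hyp js (λ y → h (g j t +v y))) ⟩
    ∑ U (λ t → ∑ (tuples U (L.length js)) (λ ts → h (g j t +v linComb g js ts)))
  ≡⟨ sym (trans (∑-concatMap _ U _) (∑-cong U (λ t → ∑-map (t ∷_) (tuples U (L.length js)) _))) ⟩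
    ∑ (tuples U (L.length (j ∷ js))) (λ ts → h (linComb g (j ∷ js) ts)) ∎
  where open ≡-Reasoning

vsum : ∀ {k} → List A → (A → Exp k) → Exp k
vsum js v = foldr (λ j acc → v j +v acc) 0v js

iteratedSums-singletons : ∀ {k} (js : List A) (v : A → Exp k) → iteratedSums js (λ j → [ v j ]) ≡ [ vsum js v ]
iteratedSums-singletons [] v = refl
iteratedSums-singletons (j ∷ js) v rewrite iteratedSums-singletons js v = refl

-- The exponents occurring in the (π, c)-term of the right-hand side: the term is
-- the sum of z^(termExp t ts) over t and ts = (s_1, …, s_n) (0-based as in Defs).
module WreathExpansion (r n : ℕ) (r>0 : 0 < r) (π : Vec (Fin n) n) (c : Vec (Fin r) n) (S : ℕ) where
  U : List ℕ
  U = upTo (suc S)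

  Mj : ℕ → Exp (suc n)
  Mj = M r n π c

  descentExp : ℕ → Exp (suc n)
  descentExp j = if isDes r n π c j ∧ (a r n π c j ≡ᵇ 0) then scale r (Mj j) else 0v

  changeExp : ℕ → Exp (suc n)
  changeExp j = scale (a r n π c j) (Mj j)

  numeratorExp : Exp (suc n)
  numeratorExp = vsum (upTo n) descentExp +v vsum (upTo n) changeExp

  u0 : Exp (suc n)
  u0 = unit F.zero

  periodExp : ℕ → ℕ → Exp (suc n)
  periodExp j t = scale t (scale r (Mj j))

  termExp : ℕ → List ℕ → Exp (suc n)
  termExp t ts = numeratorExp +v (scale t u0 +v linComb periodExp (upTo n) ts)

  descentFactors changeFactors : List (Exp (suc n))
  descentFactors = iteratedSums (upTo n) (λ j → [ descentExp j ])
  changeFactors = iteratedSums (upTo n) (λ j → [ changeExp j ])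

  counts-descentFactor : ∀ j → Counts S (if isDes r n π c j ∧ (a r n π c j ≡ᵇ 0) then mono (scale r (Mj j)) else 1s) [ descentExp j ]
  counts-descentFactor j with isDes r n π c j ∧ (a r n π c j ≡ᵇ 0)
  ... | true = Counts-mono (scale r (Mj j))
  ... | false = Counts-mono 0v

  counts-numerator : Counts S (numerator r n π c) (pairwiseSums descentFactors changeFactors)
  counts-numerator = Counts-*s {L = descentFactors} {L' = changeFactors}
    (Counts-Πs (upTo n) {L = λ j → [ descentExp j ]} counts-descentFactor)
    (Counts-Πs (upTo n) {L = λ j → [ changeExp j ]} (λ j → Counts-mono (changeExp j)))

  z₀Powers : List (Exp (suc n))
  z₀Powers = map (λ t → scale t u0) U

  periodPowers : ℕ → List (Exp (suc n))
  periodPowers j = map (periodExp j) U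

  geomFactors : List (Exp (suc n))
  geomFactors = iteratedSums (upTo n) periodPowers

  counts-invDenominator : Counts S (invDenominator r n π c) (pairwiseSums z₀Powers geomFactors)
  counts-invDenominator = Counts-*s {L = z₀Powers} {L' = geomFactors}
    (Counts-geom u0 (s≤s z≤n))
    (Counts-Πs (upTo n) {L = periodPowers} (λ j → Counts-geom (scale r (Mj j)) (subst (0 <_) (sym (ℕP.*-identityʳ r)) r>0)))

  wreathTerm-coeff : ∀ e → V.sum e ≤ S → wreathTerm r n π c e ≡ ∑ U (λ t → ∑ (tuples U n) (λ ts → 𝟙 (termExp t ts ≟v e)))
  wreathTerm-coeff e le = begin
      wreathTerm r n π c e
    ≡⟨ Counts-*s {L = pairwiseSums descentFactors changeFactors} {L' = pairwiseSums z₀Powers geomFactors}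
                 counts-numerator counts-invDenominator e le ⟩
      count (pairwiseSums (pairwiseSums descentFactors changeFactors) (pairwiseSums z₀Powers geomFactors)) e
    ≡⟨ ∑-pairwiseSums (pairwiseSums descentFactors changeFactors) _ _ ⟩
      ∑ (pairwiseSums descentFactors changeFactors) (λ x → count' (x +v_))
    ≡⟨ cong₂ (λ l l' → ∑ (pairwiseSums l l') (λ x → count' (x +v_)))
             (iteratedSums-singletons (upTo n) descentExp) (iteratedSums-singletons (upTo n) changeExp) ⟩
      count' (numeratorExp +v_) ℤ.+ 0ℤ
    ≡⟨ ℤP.+-identityʳ _ ⟩
      count' (numeratorExp +v_)
    ≡⟨ ∑-pairwiseSums z₀Powers geomFactors _ ⟩
      ∑ z₀Powers (λ x → ∑ geomFactors (λ y → 𝟙 ((numeratorExp +v (x +v y)) ≟v e)))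
    ≡⟨ ∑-map (λ t → scale t u0) U (λ x → ∑ geomFactors (λ y → 𝟙 ((numeratorExp +v (x +v y)) ≟v e))) ⟩
      ∑ U (λ t → ∑ geomFactors (λ y → 𝟙 ((numeratorExp +v (scale t u0 +v y)) ≟v e)))
    ≡⟨ ∑-cong U (λ t → ∑-iteratedSums U periodExp periodPowers (λ j h → ∑-map _ U h) (upTo n) _) ⟩
      ∑ U (λ t → ∑ (tuples U (L.length (upTo n))) (λ ts → 𝟙 (termExp t ts ≟v e)))
    ≡⟨ cong (λ m → ∑ U (λ t → ∑ (tuples U m) (λ ts → 𝟙 (termExp t ts ≟v e)))) (LP.length-upTo n) ⟩
      ∑ U (λ t → ∑ (tuples U n) (λ ts → 𝟙 (termExp t ts ≟v e))) ∎
    where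
    open ≡-Reasoning
    count' : (Exp (suc n) → Exp (suc n)) → ℤ
    count' shift = ∑ (pairwiseSums z₀Powers geomFactors) (λ y → 𝟙 (shift y ≟v e))

varExp : ∀ {n} → Fin n → ℕ → Exp (suc n)
varExp j t = scale t (unit (F.suc j))

lhsTerm-coeff : ∀ n k e → lhsTerm n k e ≡ ∑ (tuples (upTo (suc k)) n) (λ ts → 𝟙 ((linComb varExp (allFin n) ts +v scale k (unit F.zero)) ≟v e))
lhsTerm-coeff n k e = begin
    lhsTerm n k e
  ≡⟨ counts-lhsTerm e ℕP.≤-refl ⟩
    count (pairwiseSums qintFactors [ zₒᵏ ]) e
  ≡⟨ ∑-pairwiseSums qintFactors [ zₒᵏ ] (λ z → 𝟙 (z ≟v e)) ⟩
    ∑ qintFactors (λ x → 𝟙 ((x +v zₒᵏ) ≟v e) ℤ.+ 0ℤ)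
  ≡⟨ ∑-cong qintFactors (λ x → ℤP.+-identityʳ _) ⟩
    ∑ qintFactors (λ x → 𝟙 ((x +v zₒᵏ) ≟v e))
  ≡⟨ ∑-iteratedSums (upTo (suc k)) varExp qintExps qintExps-∑ (allFin n) (λ x → 𝟙 ((x +v zₒᵏ) ≟v e)) ⟩
    ∑ (tuples (upTo (suc k)) (L.length (allFin n))) (λ ts → 𝟙 ((linComb varExp (allFin n) ts +v zₒᵏ) ≟v e))
  ≡⟨ cong (λ m → ∑ (tuples (upTo (suc k)) m) (λ ts → 𝟙 ((linComb varExp (allFin n) ts +v zₒᵏ) ≟v e)))
          (LP.length-tabulate {n = n} id) ⟩
    ∑ (tuples (upTo (suc k)) n) (λ ts → 𝟙 ((linComb varExp (allFin n) ts +v zₒᵏ) ≟v e)) ∎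
  where
  open ≡-Reasoning
  zₒᵏ = scale k (unit {suc n} F.zero)
  qintExps : Fin n → List (Exp (suc n))
  qintExps j = concatMap (λ i → [ varExp j i ]) (upTo (suc k))
  qintExps-∑ : ∀ j h → ∑ (qintExps j) h ≡ ∑ (upTo (suc k)) (λ t → h (varExp j t))
  qintExps-∑ j h = trans (∑-concatMap (λ i → [ varExp j i ]) (upTo (suc k)) h)
                         (∑-cong (upTo (suc k)) {g = λ t → h (varExp j t)} (λ i → ℤP.+-identityʳ _))
  qintFactors = iteratedSums (allFin n) qintExps
  counts-lhsTerm : Counts (V.sum e) (lhsTerm n k) (pairwiseSums qintFactors [ zₒᵏ ])
  counts-lhsTerm = Counts-*s {L = qintFactors} {L' = [ zₒᵏ ]}
    (Counts-Πs (allFin n) {L = qintExps} (λ j → Counts-Σs (upTo (suc k)) {L = λ i → [ varExp j i ]} (λ i → Counts-mono (varExp j i))))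
    (Counts-mono zₒᵏ)

lhs-coeff-expanded : ∀ n e →
  lhs n e ≡ ∑ (upTo (suc (V.head e))) (λ k → ∑ (tuples (upTo (suc k)) n) (λ ts → 𝟙 ((linComb varExp (allFin n) ts +v scale k (unit F.zero)) ≟v e)))
lhs-coeff-expanded n e = trans (Σs-apply (upTo (suc (V.head e))) (lhsTerm n) e)
  (∑-cong (upTo (suc (V.head e))) (λ k → lhsTerm-coeff n k e))

rhs-coeff-expanded : ∀ r n → (r>0 : 0 < r) → ∀ e →
  rhs r n e ≡ ∑ (wreath r n) (λ p →
    ∑ (upTo (suc (V.sum e))) (λ t → ∑ (tuples (upTo (suc (V.sum e))) n) (λ ts → 𝟙 (WreathExpansion.termExp r n r>0 (proj₁ p) (proj₂ p) (V.sum e) t ts ≟v e))))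
rhs-coeff-expanded r n r>0 e = trans (Σs-apply (wreath r n) (λ p → wreathTerm r n (proj₁ p) (proj₂ p)) e)
  (∑-cong (wreath r n) (λ p → WreathExpansion.wreathTerm-coeff r n r>0 (proj₁ p) (proj₂ p) (V.sum e) e ℕP.≤-refl))

vecOf : (n : ℕ) → List ℕ → Vec ℕ n
vecOf zero _ = []
vecOf (suc n) ts = hd ts ∷ vecOf n (tl ts)

linComb-map : ∀ {k} (g : A → ℕ → Exp k) (h : B → A) js ts → linComb g (map h js) ts ≡ linComb (λ j → g (h j)) js ts
linComb-map g h [] ts = refl
linComb-map g h (j ∷ js) ts = cong (g (h j) (hd ts) +v_) (linComb-map g h js (tl ts))

linComb-suc : ∀ {m} (js : List (Fin m)) ts →
  linComb (λ j t → scale t (unit {suc m} (F.suc j))) js ts ≡ 0 ∷ linComb (λ j t → scale t (unit j)) js ts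
linComb-suc [] ts = refl
linComb-suc (j ∷ js) ts rewrite linComb-suc js (tl ts) | ℕP.*-zeroʳ (hd ts) = refl

scale-zeros-+v : ∀ {m} t (v : Exp m) → scale t (V.tabulate (λ (_ : Fin m) → 0)) +v v ≡ v
scale-zeros-+v t [] = refl
scale-zeros-+v t (x ∷ v) rewrite ℕP.*-zeroʳ t = cong (x ∷_) (scale-zeros-+v t v)

+v-scale-zeros : ∀ {m} t (v : Exp m) → v +v scale t (V.tabulate (λ (_ : Fin m) → 0)) ≡ v
+v-scale-zeros t [] = refl
+v-scale-zeros {suc m} t (x ∷ v) rewrite ℕP.*-zeroʳ t | ℕP.+-identityʳ x = cong (x ∷_) (+v-scale-zeros t v)

linComb-units : ∀ m ts → linComb (λ j t → scale t (unit {m} j)) (allFin m) ts ≡ vecOf m ts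
linComb-units zero ts = refl
linComb-units (suc m) ts = begin
    z₀ᵗ +v linComb g (L.tabulate F.suc) (tl ts)
  ≡⟨ cong (λ l → z₀ᵗ +v linComb g l (tl ts)) (sym (LP.map-tabulate id F.suc)) ⟩
    z₀ᵗ +v linComb g (map F.suc (allFin m)) (tl ts)
  ≡⟨ cong (z₀ᵗ +v_) (trans (linComb-map g F.suc (allFin m) (tl ts)) (linComb-suc (allFin m) (tl ts))) ⟩
    z₀ᵗ +v (0 ∷ linComb (λ j t → scale t (unit j)) (allFin m) (tl ts))
  ≡⟨ cong (λ v → z₀ᵗ +v (0 ∷ v)) (linComb-units m (tl ts)) ⟩
    z₀ᵗ +v (0 ∷ vecOf m (tl ts))
  ≡⟨ cong₂ _∷_ (trans (ℕP.+-identityʳ _) (ℕP.*-identityʳ (hd ts))) (scale-zeros-+v (hd ts) (vecOf m (tl ts))) ⟩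
    vecOf (suc m) ts ∎
  where
  open ≡-Reasoning
  g = λ (j : Fin (suc m)) t → scale t (unit j)
  z₀ᵗ = scale (hd ts) (unit {suc m} F.zero)

lhsTerm-exp : ∀ n k ts → linComb varExp (allFin n) ts +v scale k (unit F.zero) ≡ k ∷ vecOf n ts
lhsTerm-exp n k ts rewrite linComb-suc (allFin n) ts | linComb-units n ts | ℕP.*-identityʳ k =
  cong (k ∷_) (+v-scale-zeros k (vecOf n ts))

∑-tuples-vecOf : ∀ m n (v : Vec ℕ n) → ∑ (tuples (upTo m) n) (λ ts → 𝟙 (vecOf n ts ≟v v)) ≡ 𝟙 (VA.all? (ℕ._<? m) v)
∑-tuples-vecOf m zero [] = refl
∑-tuples-vecOf m (suc n) (y ∷ v) = begin
    ∑ (concatMap (λ t → map (t ∷_) (tuples (upTo m) n)) (upTo m)) h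
  ≡⟨ ∑-concatMap _ (upTo m) h ⟩
    ∑ (upTo m) (λ t → ∑ (map (t ∷_) (tuples (upTo m) n)) h)
  ≡⟨ ∑-cong (upTo m) (λ t → trans (∑-map (t ∷_) (tuples (upTo m) n) h) (splitHead t)) ⟩
    ∑ (upTo m) (λ t → 𝟙 (y ℕ.≟ t) ℤ.* ∑ (tuples (upTo m) n) (λ ts → 𝟙 (vecOf n ts ≟v v)))
  ≡⟨ ∑-upTo-𝟙≟ m y _ ⟩
    𝟙 (y ℕ.<? m) ℤ.* ∑ (tuples (upTo m) n) (λ ts → 𝟙 (vecOf n ts ≟v v))
  ≡⟨ cong (𝟙 (y ℕ.<? m) ℤ.*_) (∑-tuples-vecOf m n v) ⟩
    𝟙 (y ℕ.<? m) ℤ.* 𝟙 (VA.all? (ℕ._<? m) v)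
  ≡⟨ sym (𝟙-× (y ℕ.<? m) (VA.all? (ℕ._<? m) v)) ⟩
    𝟙 ((y ℕ.<? m) ×-dec VA.all? (ℕ._<? m) v)
  ≡⟨ 𝟙-cong _ _ (λ { (p , q) → p VA.∷ q }) (λ { (p VA.∷ q) → p , q }) ⟩
    𝟙 (VA.all? (ℕ._<? m) (y ∷ v)) ∎
  where
  open ≡-Reasoning
  h = λ ts → 𝟙 (vecOf (suc n) ts ≟v (y ∷ v))
  splitHead : ∀ t → ∑ (tuples (upTo m) n) (λ ts → 𝟙 ((t ∷ vecOf n ts) ≟v (y ∷ v)))
                    ≡ 𝟙 (y ℕ.≟ t) ℤ.* ∑ (tuples (upTo m) n) (λ ts → 𝟙 (vecOf n ts ≟v v))
  splitHead t = trans (∑-cong (tuples (upTo m) n) (λ ts → trans (𝟙-≟v-∷ t y (vecOf n ts) v)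
                                                               (cong (ℤ._* 𝟙 (vecOf n ts ≟v v)) (𝟙-sym t y))))
                      (sym (∑-*ˡ (tuples (upTo m) n) (𝟙 (y ℕ.≟ t)) _))

InCone : ∀ {n} → Exp (suc n) → Set
InCone e = VAll (λ x → x < suc (V.head e)) (V.tail e)

inCone? : ∀ {n} (e : Exp (suc n)) → Dec (InCone e)
inCone? e = VA.all? (ℕ._<? suc (V.head e)) (V.tail e)

lhs-coeff : ∀ n (e : Exp (suc n)) → lhs n e ≡ 𝟙 (inCone? e)
lhs-coeff n (e₀ ∷ e') = begin
    lhs n (e₀ ∷ e')
  ≡⟨ lhs-coeff-expanded n (e₀ ∷ e') ⟩
    ∑ (upTo (suc e₀)) (λ k → ∑ (tuples (upTo (suc k)) n) (λ ts → 𝟙 ((linComb varExp (allFin n) ts +v scale k (unit F.zero)) ≟v (e₀ ∷ e'))))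
  ≡⟨ ∑-cong (upTo (suc e₀)) kthTerm ⟩
    ∑ (upTo (suc e₀)) (λ k → 𝟙 (e₀ ℕ.≟ k) ℤ.* 𝟙 (VA.all? (ℕ._<? suc k) e'))
  ≡⟨ ∑-upTo-𝟙≟ (suc e₀) e₀ (λ k → 𝟙 (VA.all? (ℕ._<? suc k) e')) ⟩
    𝟙 (e₀ ℕ.<? suc e₀) ℤ.* 𝟙 (inCone? (e₀ ∷ e'))
  ≡⟨ cong (ℤ._* 𝟙 (inCone? (e₀ ∷ e'))) (𝟙-yes (e₀ ℕ.<? suc e₀) ℕP.≤-refl) ⟩
    1ℤ ℤ.* 𝟙 (inCone? (e₀ ∷ e'))
  ≡⟨ ℤP.*-identityˡ _ ⟩
    𝟙 (inCone? (e₀ ∷ e')) ∎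
  where
  open ≡-Reasoning
  kthTerm : ∀ k → ∑ (tuples (upTo (suc k)) n) (λ ts → 𝟙 ((linComb varExp (allFin n) ts +v scale k (unit F.zero)) ≟v (e₀ ∷ e')))
                  ≡ 𝟙 (e₀ ℕ.≟ k) ℤ.* 𝟙 (VA.all? (ℕ._<? suc k) e')
  kthTerm k = begin
      ∑ (tuples (upTo (suc k)) n) (λ ts → 𝟙 ((linComb varExp (allFin n) ts +v scale k (unit F.zero)) ≟v (e₀ ∷ e')))
    ≡⟨ ∑-cong (tuples (upTo (suc k)) n) (λ ts → trans (cong (λ z → 𝟙 (z ≟v (e₀ ∷ e'))) (lhsTerm-exp n k ts))
                                                      (𝟙-≟v-∷ k e₀ (vecOf n ts) e')) ⟩
      ∑ (tuples (upTo (suc k)) n) (λ ts → 𝟙 (k ℕ.≟ e₀) ℤ.* 𝟙 (vecOf n ts ≟v e'))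
    ≡⟨ sym (∑-*ˡ (tuples (upTo (suc k)) n) (𝟙 (k ℕ.≟ e₀)) _) ⟩
      𝟙 (k ℕ.≟ e₀) ℤ.* ∑ (tuples (upTo (suc k)) n) (λ ts → 𝟙 (vecOf n ts ≟v e'))
    ≡⟨ cong₂ ℤ._*_ (𝟙-sym k e₀) (∑-tuples-vecOf (suc k) n e') ⟩
      𝟙 (e₀ ℕ.≟ k) ℤ.* 𝟙 (VA.all? (ℕ._<? suc k) e') ∎

∑ℕ : List A → (A → ℕ) → ℕ
∑ℕ xs f = foldr _+_ 0 (map f xs)

∑ℕ-cong : ∀ (xs : List A) {f g : A → ℕ} → (∀ x → f x ≡ g x) → ∑ℕ xs f ≡ ∑ℕ xs g
∑ℕ-cong [] eq = refl
∑ℕ-cong (x ∷ xs) eq = cong₂ _+_ (eq x) (∑ℕ-cong xs eq)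

∑ℕ-cong-All : ∀ {xs : List A} {f g : A → ℕ} → All (λ x → f x ≡ g x) xs → ∑ℕ xs f ≡ ∑ℕ xs g
∑ℕ-cong-All [] = refl
∑ℕ-cong-All (p ∷ ps) = cong₂ _+_ p (∑ℕ-cong-All ps)

∑ℕ-+ : ∀ (xs : List A) f g → ∑ℕ xs (λ x → f x + g x) ≡ ∑ℕ xs f + ∑ℕ xs g
∑ℕ-+ [] f g = refl
∑ℕ-+ (x ∷ xs) f g rewrite ∑ℕ-+ xs f g = ℕ+.interchange (f x) (g x) (∑ℕ xs f) (∑ℕ xs g)

∑ℕ-map : ∀ (h : B → A) (xs : List B) f → ∑ℕ (map h xs) f ≡ ∑ℕ xs (λ x → f (h x))
∑ℕ-map h [] f = refl
∑ℕ-map h (x ∷ xs) f = cong (f (h x) +_) (∑ℕ-map h xs f)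

∑ℕ-upTo-suc : ∀ m f → ∑ℕ (upTo (suc m)) f ≡ f 0 + ∑ℕ (upTo m) (λ j → f (suc j))
∑ℕ-upTo-suc m f = cong (f 0 +_) (trans (cong (λ l → ∑ℕ l f) (sym (LP.map-upTo suc m))) (∑ℕ-map suc (upTo m) f))

lookup-+v : ∀ {k} (a b : Exp k) q → V.lookup (a +v b) q ≡ V.lookup a q + V.lookup b q
lookup-+v a b q = VP.lookup-zipWith _+_ q a b

lookup-scale : ∀ {k} t (v : Exp k) q → V.lookup (scale t v) q ≡ t * V.lookup v q
lookup-scale t v q = VP.lookup-map q (t *_) v

lookup-0v : ∀ {k} (q : Fin k) → V.lookup (0v {k}) q ≡ 0
lookup-0v q = VP.lookup-replicate q 0

lookup-vsum : ∀ {k} (js : List A) (v : A → Exp k) q → V.lookup (vsum js v) q ≡ ∑ℕ js (λ j → V.lookup (v j) q)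
lookup-vsum [] v q = lookup-0v q
lookup-vsum (j ∷ js) v q = trans (lookup-+v (v j) _ q) (cong (V.lookup (v j) q +_) (lookup-vsum js v q))

nth-tl : ∀ ts j → nth ts (suc j) ≡ nth (tl ts) j
nth-tl [] j = refl
nth-tl (x ∷ ts) j = refl

nth-hd : ∀ ts → nth ts 0 ≡ hd ts
nth-hd [] = refl
nth-hd (x ∷ ts) = refl

lookup-linComb : ∀ {k} (g : ℕ → ℕ → Exp k) f m ts q →
  V.lookup (linComb g (applyUpTo f m) ts) q ≡ ∑ℕ (upTo m) (λ j → V.lookup (g (f j) (nth ts j)) q)
lookup-linComb g f zero ts q = lookup-0v q
lookup-linComb g f (suc m) ts q = begin
    V.lookup (g (f 0) (hd ts) +v linComb g (applyUpTo (f ∘ suc) m) (tl ts)) q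
  ≡⟨ lookup-+v (g (f 0) (hd ts)) _ q ⟩
    V.lookup (g (f 0) (hd ts)) q + V.lookup (linComb g (applyUpTo (f ∘ suc) m) (tl ts)) q
  ≡⟨ cong₂ _+_ (cong (λ z → V.lookup (g (f 0) z) q) (sym (nth-hd ts))) (lookup-linComb g (f ∘ suc) m (tl ts) q) ⟩
    V.lookup (g (f 0) (nth ts 0)) q + ∑ℕ (upTo m) (λ j → V.lookup (g (f (suc j)) (nth (tl ts) j)) q)
  ≡⟨ cong (V.lookup (g (f 0) (nth ts 0)) q +_) (∑ℕ-cong (upTo m) (λ j → cong (λ z → V.lookup (g (f (suc j)) z) q) (sym (nth-tl ts j)))) ⟩
    V.lookup (g (f 0) (nth ts 0)) q + ∑ℕ (upTo m) (λ j → V.lookup (g (f (suc j)) (nth ts (suc j))) q)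
  ≡⟨ sym (∑ℕ-upTo-suc m (λ j → V.lookup (g (f j) (nth ts j)) q)) ⟩
    ∑ℕ (upTo (suc m)) (λ j → V.lookup (g (f j) (nth ts j)) q) ∎
  where open ≡-Reasoning

module WreathCoordinates (r n : ℕ) (r>0 : 0 < r) (π : Vec (Fin n) n) (c : Vec (Fin r) n) (S : ℕ) where
  open WreathExpansion r n r>0 π c S

  descentWeight : ℕ → ℕ
  descentWeight j = if isDes r n π c j ∧ (a r n π c j ≡ᵇ 0) then r else 0

  -- Total multiplicity of M_j in termExp t ts.
  weight : List ℕ → ℕ → ℕ
  weight ts j = descentWeight j + a r n π c j + r * nth ts j

  lookup-descentExp : ∀ j q → V.lookup (descentExp j) q ≡ descentWeight j * V.lookup (Mj j) q
  lookup-descentExp j q with isDes r n π c j ∧ (a r n π c j ≡ᵇ 0)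
  ... | true = lookup-scale r (Mj j) q
  ... | false = lookup-0v q

  lookup-termExp : ∀ t ts q → V.lookup (termExp t ts) q ≡ t * V.lookup u0 q + ∑ℕ (upTo n) (λ j → weight ts j * V.lookup (Mj j) q)
  lookup-termExp t ts q = begin
      V.lookup (termExp t ts) q
    ≡⟨ lookup-+v numeratorExp _ q ⟩
      V.lookup numeratorExp q + V.lookup (scale t u0 +v linComb periodExp (upTo n) ts) q
    ≡⟨ cong₂ _+_ lookup-numerator (trans (lookup-+v (scale t u0) (linComb periodExp (upTo n) ts) q) (cong₂ _+_ (lookup-scale t u0 q) lookup-periods)) ⟩
      (∑ℕ (upTo n) D + ∑ℕ (upTo n) C) + (t * V.lookup u0 q + ∑ℕ (upTo n) P)
    ≡⟨ ℕ+.x∙yz≈y∙xz (∑ℕ (upTo n) D + ∑ℕ (upTo n) C) (t * V.lookup u0 q) (∑ℕ (upTo n) P) ⟩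
      t * V.lookup u0 q + ((∑ℕ (upTo n) D + ∑ℕ (upTo n) C) + ∑ℕ (upTo n) P)
    ≡⟨ cong (t * V.lookup u0 q +_) (trans (cong (_+ ∑ℕ (upTo n) P) (sym (∑ℕ-+ (upTo n) D C))) (sym (∑ℕ-+ (upTo n) _ P))) ⟩
      t * V.lookup u0 q + ∑ℕ (upTo n) (λ j → D j + C j + P j)
    ≡⟨ cong (t * V.lookup u0 q +_) (∑ℕ-cong (upTo n) (λ j → collect (descentWeight j) (a r n π c j) (nth ts j) r (V.lookup (Mj j) q))) ⟩
      t * V.lookup u0 q + ∑ℕ (upTo n) (λ j → weight ts j * V.lookup (Mj j) q) ∎
    where
    open ≡-Reasoning
    D C P : ℕ → ℕ
    D j = descentWeight j * V.lookup (Mj j) q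
    C j = a r n π c j * V.lookup (Mj j) q
    P j = nth ts j * (r * V.lookup (Mj j) q)
    lookup-numerator : V.lookup numeratorExp q ≡ ∑ℕ (upTo n) D + ∑ℕ (upTo n) C
    lookup-numerator = trans (lookup-+v (vsum (upTo n) descentExp) (vsum (upTo n) changeExp) q)
      (cong₂ _+_ (trans (lookup-vsum (upTo n) descentExp q) (∑ℕ-cong (upTo n) (λ j → lookup-descentExp j q)))
                 (trans (lookup-vsum (upTo n) changeExp q) (∑ℕ-cong (upTo n) (λ j → lookup-scale (a r n π c j) (Mj j) q))))
    lookup-periods : V.lookup (linComb periodExp (upTo n) ts) q ≡ ∑ℕ (upTo n) P
    lookup-periods = trans (lookup-linComb periodExp id n ts q)
      (∑ℕ-cong (upTo n) (λ j → trans (lookup-scale (nth ts j) (scale r (Mj j)) q) (cong (nth ts j *_) (lookup-scale r (Mj j) q))))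
    collect : ∀ x y s r m → x * m + y * m + s * (r * m) ≡ (x + y + r * s) * m
    collect = solve-∀

nth-∈ : ∀ xs k → k < L.length xs → nth xs k ∈ xs
nth-∈ (x ∷ xs) zero _ = here refl
nth-∈ (x ∷ xs) (suc k) (s≤s p) = there (nth-∈ xs k p)

∈-nth : ∀ {y} xs → y ∈ xs → Σ ℕ (λ k → k < L.length xs × nth xs k ≡ y)
∈-nth (x ∷ xs) (here refl) = zero , s≤s z≤n , refl
∈-nth (x ∷ xs) (there p) with ∈-nth xs p
... | k , lt , eq = suc k , s≤s lt , eq

nth-ext : ∀ xs ys → L.length xs ≡ L.length ys → (∀ k → k < L.length xs → nth xs k ≡ nth ys k) → xs ≡ ys
nth-ext [] [] _ _ = refl
nth-ext (x ∷ xs) (y ∷ ys) len eq = cong₂ _∷_ (eq 0 (s≤s z≤n)) (nth-ext xs ys (ℕP.suc-injective len) (λ k k< → eq (suc k) (s≤s k<)))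

any-≡ᵇ : ∀ x xs → x ∈ xs → any (x ≡ᵇ_) xs ≡ true
any-≡ᵇ x xs p = any≡true⇐ (x ≡ᵇ_) xs (Any.map (λ { refl → ≡ᵇ-refl x }) p)

distinct-∷⁻ : ∀ x xs → distinct (x ∷ xs) ≡ true → (x ∉ xs) × distinct xs ≡ true
distinct-∷⁻ x xs eq with any (x ≡ᵇ_) xs in any≡ | distinct xs
... | false | true = (λ x∈xs → false≢true (trans (sym any≡) (any-≡ᵇ x xs x∈xs))) , refl
... | false | false = ⊥-elim (false≢true eq)
... | true | _ = ⊥-elim (false≢true eq)

NthInjective : List ℕ → Set
NthInjective xs = ∀ j k → j < L.length xs → k < L.length xs → nth xs j ≡ nth xs k → j ≡ k

distinct⇒nth-injective : ∀ xs → distinct xs ≡ true → NthInjective xs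
distinct⇒nth-injective (x ∷ xs) d zero zero _ _ _ = refl
distinct⇒nth-injective (x ∷ xs) d zero (suc k) _ (s≤s k<) eq =
  ⊥-elim (proj₁ (distinct-∷⁻ x xs d) (subst (_∈ xs) (sym eq) (nth-∈ xs k k<)))
distinct⇒nth-injective (x ∷ xs) d (suc j) zero (s≤s j<) _ eq =
  ⊥-elim (proj₁ (distinct-∷⁻ x xs d) (subst (_∈ xs) eq (nth-∈ xs j j<)))
distinct⇒nth-injective (x ∷ xs) d (suc j) (suc k) (s≤s j<) (s≤s k<) eq =
  cong suc (distinct⇒nth-injective xs (proj₂ (distinct-∷⁻ x xs d)) j k j< k< eq)

nth-injective⇒distinct : ∀ xs → NthInjective xs → distinct xs ≡ true
nth-injective⇒distinct [] inj = refl
nth-injective⇒distinct (x ∷ xs) inj with any (x ≡ᵇ_) xs in any≡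
... | false = nth-injective⇒distinct xs (λ j k j< k< eq → ℕP.suc-injective (inj (suc j) (suc k) (s≤s j<) (s≤s k<) eq))
... | true with find (any≡true⇒ (x ≡ᵇ_) xs any≡)
...   | y , y∈xs , x≡ᵇy with ∈-nth xs y∈xs
...     | k , k< , nth≡y = ⊥-elim (ℕP.0≢1+n (inj 0 (suc k) (s≤s z≤n) (s≤s k<) (trans (≡ᵇ≡true⇒≡ x≡ᵇy) (sym nth≡y))))

IncreasingBelow : ℕ → (ℕ → ℕ) → Set
IncreasingBelow n h = ∀ j → suc j < n → h j < h (suc j)

increasing⇒< : ∀ {n h} → IncreasingBelow n h → ∀ {j k} → j < k → k < n → h j < h k
increasing⇒< hi {j} {suc k} (s≤s j≤k) k<n with ℕP.m≤n⇒m<n∨m≡n j≤k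
... | inj₁ j<k = ℕP.<-trans (increasing⇒< hi j<k (ℕP.<-trans (ℕP.n<1+n k) k<n)) (hi k k<n)
... | inj₂ refl = hi j k<n

increasing⇒injective : ∀ {n h} → IncreasingBelow n h → ∀ j k → j < n → k < n → h j ≡ h k → j ≡ k
increasing⇒injective hi j k j<n k<n eq with ℕP.<-cmp j k
... | tri< j<k _ _ = ⊥-elim (ℕP.<-irrefl eq (increasing⇒< hi j<k k<n))
... | tri≈ _ j≡k _ = j≡k
... | tri> _ _ k<j = ⊥-elim (ℕP.<-irrefl (sym eq) (increasing⇒< hi k<j j<n))

-- By induction on j: f j is some g k, and k < j, k > j both contradict monotonicity
-- (the latter after also writing g j as some f k').
module IncreasingSameImage (n : ℕ) (f g : ℕ → ℕ) (f-inc : IncreasingBelow n f) (g-inc : IncreasingBelow n g)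
  (f⊆g : ∀ j → j < n → Σ ℕ (λ k → k < n × f j ≡ g k)) (g⊆f : ∀ j → j < n → Σ ℕ (λ k → k < n × g j ≡ f k)) where

  agreeBelow : ∀ m j → j < m → j < n → f j ≡ g j
  agreeBelow (suc m) j (s≤s j≤m) j<n with ℕP.m≤n⇒m<n∨m≡n j≤m
  ... | inj₁ j<m = agreeBelow m j j<m j<n
  ... | inj₂ refl with f⊆g j j<n
  ... | k , k<n , fj≡gk with ℕP.<-cmp k j
  ... | tri< k<j _ _ = ⊥-elim (ℕP.<-irrefl (trans (agreeBelow j k k<j k<n) (sym fj≡gk)) (increasing⇒< f-inc k<j j<n))
  ... | tri≈ _ refl _ = fj≡gk
  ... | tri> _ _ j<k with g⊆f j j<n
  ... | k' , k'<n , gj≡fk' with ℕP.<-cmp k' j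
  ... | tri< k'<j _ _ = ⊥-elim (ℕP.<-irrefl (trans (sym (agreeBelow j k' k'<j k'<n)) (sym gj≡fk')) (increasing⇒< g-inc k'<j j<n))
  ... | tri≈ _ refl _ = sym gj≡fk'
  ... | tri> _ _ j<k' = ⊥-elim (ℕP.<-asym (subst (g j <_) (sym fj≡gk) (increasing⇒< g-inc j<k k<n))
                                           (subst (f j <_) (sym gj≡fk') (increasing⇒< f-inc j<k' k'<n)))

  increasing-same-image : ∀ j → j < n → f j ≡ g j
  increasing-same-image j j<n = agreeBelow (suc j) j ℕP.≤-refl j<n

module InsertionSort (κ : ℕ → ℕ) where
  insert : ℕ → List ℕ → List ℕ
  insert x [] = x ∷ []
  insert x (y ∷ ys) with κ x ℕ.<? κ y
  ... | yes _ = x ∷ y ∷ ys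
  ... | no _ = y ∷ insert x ys

  sort : List ℕ → List ℕ
  sort = foldr insert []

  Low : ℕ → List ℕ → Set
  Low x [] = ⊤
  Low x (y ∷ _) = κ x < κ y

  Sorted : List ℕ → Set
  Sorted [] = ⊤
  Sorted (x ∷ xs) = Low x xs × Sorted xs

  insert-low : ∀ z x ys → κ z < κ x → Low z ys → Low z (insert x ys)
  insert-low z x [] lt _ = lt
  insert-low z x (y ∷ ys) lt lo with κ x ℕ.<? κ y
  ... | yes _ = lt
  ... | no _ = lo

  insert-sorted : ∀ x ys → Sorted ys → All (λ y → κ x ≢ κ y) ys → Sorted (insert x ys)
  insert-sorted x [] _ _ = tt , tt
  insert-sorted x (y ∷ ys) (lo , so) (ne ∷ nes) with κ x ℕ.<? κ y
  ... | yes lt = lt , lo , so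
  ... | no nlt = insert-low y x ys (ℕP.≤∧≢⇒< (ℕP.≮⇒≥ nlt) (λ e → ne (sym e))) lo , insert-sorted x ys so nes

  insert-length : ∀ x ys → L.length (insert x ys) ≡ suc (L.length ys)
  insert-length x [] = refl
  insert-length x (y ∷ ys) with κ x ℕ.<? κ y
  ... | yes _ = refl
  ... | no _ = cong suc (insert-length x ys)

  insert-∈⁻ : ∀ {z} x ys → z ∈ insert x ys → z ≡ x ⊎ z ∈ ys
  insert-∈⁻ x [] (here p) = inj₁ p
  insert-∈⁻ x (y ∷ ys) m with κ x ℕ.<? κ y
  insert-∈⁻ x (y ∷ ys) (here p) | yes _ = inj₁ p
  insert-∈⁻ x (y ∷ ys) (there m) | yes _ = inj₂ m
  insert-∈⁻ x (y ∷ ys) (here p) | no _ = inj₂ (here p)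
  insert-∈⁻ x (y ∷ ys) (there m) | no _ with insert-∈⁻ x ys m
  ... | inj₁ p = inj₁ p
  ... | inj₂ q = inj₂ (there q)

  insert-∈-new : ∀ x ys → x ∈ insert x ys
  insert-∈-new x [] = here refl
  insert-∈-new x (y ∷ ys) with κ x ℕ.<? κ y
  ... | yes _ = here refl
  ... | no _ = there (insert-∈-new x ys)

  insert-∈-old : ∀ {z} x ys → z ∈ ys → z ∈ insert x ys
  insert-∈-old x (y ∷ ys) m with κ x ℕ.<? κ y
  insert-∈-old x (y ∷ ys) m | yes _ = there m
  insert-∈-old x (y ∷ ys) (here p) | no _ = here p
  insert-∈-old x (y ∷ ys) (there m) | no _ = there (insert-∈-old x ys m)

  sort-∈⁻ : ∀ {z} xs → z ∈ sort xs → z ∈ xs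
  sort-∈⁻ (x ∷ xs) m with insert-∈⁻ x (sort xs) m
  ... | inj₁ p = here p
  ... | inj₂ q = there (sort-∈⁻ xs q)

  sort-∈⁺ : ∀ {z} xs → z ∈ xs → z ∈ sort xs
  sort-∈⁺ (x ∷ xs) (here refl) = insert-∈-new x (sort xs)
  sort-∈⁺ (x ∷ xs) (there m) = insert-∈-old x (sort xs) (sort-∈⁺ xs m)

  sort-length : ∀ xs → L.length (sort xs) ≡ L.length xs
  sort-length [] = refl
  sort-length (x ∷ xs) = trans (insert-length x (sort xs)) (cong suc (sort-length xs))

  sort-sorted : ∀ xs → Unique xs → (∀ {a b} → a ∈ xs → b ∈ xs → κ a ≡ κ b → a ≡ b) → Sorted (sort xs)
  sort-sorted [] _ _ = tt
  sort-sorted (x ∷ xs) (nx ∷ u) inj = insert-sorted x (sort xs) (sort-sorted xs u (λ ma mb → inj (there ma) (there mb)))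
    (All.tabulate (λ {y} my e → All.lookup nx (sort-∈⁻ xs my) (inj (here refl) (there (sort-∈⁻ xs my)) e)))

  sorted-nth-< : ∀ xs → Sorted xs → ∀ k → suc k < L.length xs → κ (nth xs k) < κ (nth xs (suc k))
  sorted-nth-< (x ∷ y ∷ xs) (lo , so) zero _ = lo
  sorted-nth-< (x ∷ y ∷ xs) (lo , so) (suc k) (s≤s lt) = sorted-nth-< (y ∷ xs) so k lt
  sorted-nth-< (x ∷ []) _ zero (s≤s ())

toℕs : ∀ {m n} → Vec (Fin m) n → List ℕ
toℕs v = map toℕ (V.toList v)

toℕs-length : ∀ {m n} (v : Vec (Fin m) n) → L.length (toℕs v) ≡ n
toℕs-length [] = refl
toℕs-length (x ∷ v) = cong suc (toℕs-length v)

nth-toℕs : ∀ {m n} (v : Vec (Fin m) n) (k : Fin n) → nth (toℕs v) (toℕ k) ≡ toℕ (V.lookup v k)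
nth-toℕs (x ∷ v) F.zero = refl
nth-toℕs (x ∷ v) (F.suc k) = nth-toℕs v k

nth-toℕs-< : ∀ {m n} (v : Vec (Fin m) n) k → k < n → nth (toℕs v) k < m
nth-toℕs-< (x ∷ v) zero _ = FP.toℕ<n x
nth-toℕs-< (x ∷ v) (suc k) (s≤s lt) = nth-toℕs-< v k lt

nth-beyond : ∀ xs k → L.length xs ≤ k → nth xs k ≡ 0
nth-beyond [] k _ = refl
nth-beyond (x ∷ xs) (suc k) (s≤s le) = nth-beyond xs k le

injective⇒surjective : ∀ {n} (f : Fin n → Fin n) → (∀ a b → f a ≡ f b → a ≡ b) → ∀ i → Σ (Fin n) (λ k → f k ≡ i)
injective⇒surjective {suc n'} f inj i with FP.any? (λ k → f k F.≟ i)
... | yes w = w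
... | no nw = ⊥-elim (ℕP.<-irrefl refl (FP.injective⇒≤ {f = h} hinj))
  where
  h : Fin (suc n') → Fin n'
  h k = F.punchOut {i = i} {j = f k} (λ eq → nw (k , sym eq))
  hinj : ∀ {a b} → h a ≡ h b → a ≡ b
  hinj {a} {b} eq = inj a b (FP.punchOut-injective (λ eq' → nw (a , sym eq')) (λ eq' → nw (b , sym eq')) eq)

module PermutationSurjective {n : ℕ} (π : Vec (Fin n) n) (d : distinct (toℕs π) ≡ true) where
  lookup-injective : ∀ a b → V.lookup π a ≡ V.lookup π b → a ≡ b
  lookup-injective a b eq = FP.toℕ-injective (distinct⇒nth-injective (toℕs π) d (toℕ a) (toℕ b)
    (subst (toℕ a <_) (sym (toℕs-length π)) (FP.toℕ<n a)) (subst (toℕ b <_) (sym (toℕs-length π)) (FP.toℕ<n b))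
    (trans (nth-toℕs π a) (trans (cong toℕ eq) (sym (nth-toℕs π b)))))

  lookup-surjective : ∀ (i : Fin n) → Σ (Fin n) (λ k → V.lookup π k ≡ i)
  lookup-surjective = injective⇒surjective (V.lookup π) lookup-injective

  nth-surjective : ∀ i → i < n → Σ ℕ (λ k → k < n × nth (toℕs π) k ≡ i)
  nth-surjective i i<n with lookup-surjective (F.fromℕ< i<n)
  ... | k , eq = toℕ k , FP.toℕ<n k , trans (nth-toℕs π k) (trans (cong toℕ eq) (FP.toℕ-fromℕ< i<n))

-- modDiff x y = (x − y) mod r is the colour change a of Defs, and coloursOf turns a
-- list of changes back into the unique colour list having them (with c_{n+1} = 0).
module ColourChanges (r : ℕ) (r>0 : 0 < r) where
  instance
    r-nonZero : NonZero r
    r-nonZero = ℕ.>-nonZero r>0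

  modDiff : ℕ → ℕ → ℕ
  modDiff x y = if y ≤ᵇ x then x ∸ y else (r + x) ∸ y

  modDiff<r : ∀ x y → x < r → y < r → modDiff x y < r
  modDiff<r x y x<r y<r with y ℕ.≤? x
  ... | yes y≤x rewrite ≤⇒≤ᵇ≡true y≤x = ℕP.≤-<-trans (ℕP.m∸n≤m x y) x<r
  ... | no y≰x rewrite ≰⇒≤ᵇ≡false y≰x =
    subst (λ z → (r + x) ∸ y < z) (ℕP.m+n∸n≡m r y) (ℕP.∸-monoˡ-< (ℕP.+-monoʳ-< r (ℕP.≰⇒> y≰x)) (ℕP.≤-trans (ℕP.<⇒≤ y<r) (ℕP.m≤m+n r x)))

  modDiff-+ : ∀ x y → x < r → y < r → (y + modDiff x y) % r ≡ x
  modDiff-+ x y x<r y<r with y ℕ.≤? x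
  ... | yes y≤x rewrite ≤⇒≤ᵇ≡true y≤x | ℕP.m+[n∸m]≡n y≤x = m<n⇒m%n≡m x<r
  ... | no y≰x rewrite ≰⇒≤ᵇ≡false y≰x | ℕP.m+[n∸m]≡n (ℕP.≤-trans (ℕP.<⇒≤ y<r) (ℕP.m≤m+n r x)) | ℕP.+-comm r x =
    trans ([m+n]%n≡m%n x r) (m<n⇒m%n≡m x<r)

  modDiff-+-inverse : ∀ y A → y < r → A < r → modDiff ((y + A) % r) y ≡ A
  modDiff-+-inverse y A y<r A<r with y + A ℕ.<? r
  ... | yes lt rewrite m<n⇒m%n≡m lt | ≤⇒≤ᵇ≡true (ℕP.m≤m+n y A) = ℕP.m+n∸m≡n y A
  ... | no nlt = overflow
    where
    r≤y+A : r ≤ y + A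
    r≤y+A = ℕP.≮⇒≥ nlt
    z = y + A ∸ r
    [y+A]%r≡z : (y + A) % r ≡ z
    [y+A]%r≡z = trans (cong (_% r) (sym (ℕP.m∸n+n≡m r≤y+A))) (trans ([m+n]%n≡m%n z r)
      (m<n⇒m%n≡m (subst (λ w → z < w) (ℕP.m+n∸n≡m r r) (ℕP.∸-monoˡ-< (ℕP.+-mono-< y<r A<r) r≤y+A))))
    z<y : z < y
    z<y = subst (λ w → z < w) (ℕP.m+n∸n≡m y r) (ℕP.∸-monoˡ-< (ℕP.+-monoʳ-< y A<r) r≤y+A)
    overflow : modDiff ((y + A) % r) y ≡ A
    overflow rewrite [y+A]%r≡z | ≰⇒≤ᵇ≡false (ℕP.<⇒≱ z<y) =
      trans (cong (_∸ y) (trans (ℕP.+-comm r z) (ℕP.m∸n+n≡m r≤y+A))) (ℕP.m+n∸m≡n y A)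

  coloursOf : List ℕ → List ℕ
  coloursOf [] = []
  coloursOf (A ∷ As) = ((hd (coloursOf As) + A) % r) ∷ coloursOf As

  coloursOf-length : ∀ As → L.length (coloursOf As) ≡ L.length As
  coloursOf-length [] = refl
  coloursOf-length (A ∷ As) = cong suc (coloursOf-length As)

  hd-< : ∀ xs → All (_< r) xs → hd xs < r
  hd-< [] _ = r>0
  hd-< (x ∷ xs) (p ∷ _) = p

  coloursOf-< : ∀ As → All (_< r) (coloursOf As)
  coloursOf-< [] = []
  coloursOf-< (A ∷ As) = m%n<n _ r ∷ coloursOf-< As

  coloursOf-changes : ∀ As j → All (_< r) As → j < L.length As →
    modDiff (nth (coloursOf As) j) (nth (coloursOf As) (suc j)) ≡ nth As j
  coloursOf-changes (A ∷ As) zero (A<r ∷ _) _ =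
    trans (cong (modDiff ((hd (coloursOf As) + A) % r)) (nth-hd (coloursOf As)))
          (modDiff-+-inverse (hd (coloursOf As)) A (hd-< (coloursOf As) (coloursOf-< As)) A<r)
  coloursOf-changes (A ∷ As) (suc j) (_ ∷ ps) (s≤s lt) = coloursOf-changes As j ps lt

  coloursOf-unique : ∀ cl As → L.length cl ≡ L.length As → All (_< r) cl →
    (∀ j → j < L.length As → modDiff (nth cl j) (nth cl (suc j)) ≡ nth As j) → cl ≡ coloursOf As
  coloursOf-unique [] [] _ _ _ = refl
  coloursOf-unique (x ∷ cl) (A ∷ As) len (x<r ∷ cl<r) changes = cong₂ _∷_ x≡ cl≡
    where
    cl≡ : cl ≡ coloursOf As
    cl≡ = coloursOf-unique cl As (ℕP.suc-injective len) cl<r (λ j lt → changes (suc j) (s≤s lt))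
    x≡ : x ≡ (hd (coloursOf As) + A) % r
    x≡ = begin
        x
      ≡⟨ sym (modDiff-+ x (hd cl) x<r (hd-< cl cl<r)) ⟩
        (hd cl + modDiff x (hd cl)) % r
      ≡⟨ cong (λ z → (hd cl + z) % r) (trans (cong (modDiff x) (sym (nth-hd cl))) (changes 0 (s≤s z≤n))) ⟩
        (hd cl + A) % r
      ≡⟨ cong (λ z → (hd z + A) % r) cl≡ ⟩
        (hd (coloursOf As) + A) % r ∎
      where open ≡-Reasoning

suffixSum : (ℕ → ℕ) → ℕ → ℕ → ℕ
suffixSum w m k = ∑ℕ (upTo m) (λ j → if k ≤ᵇ j then w j else 0)

≤ᵇ-suc : ∀ k j → (suc k ≤ᵇ suc j) ≡ (k ≤ᵇ j)
≤ᵇ-suc zero j = refl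
≤ᵇ-suc (suc k) j = refl

suffixSum-suc : ∀ w m k → suffixSum w (suc m) (suc k) ≡ suffixSum (λ j → w (suc j)) m k
suffixSum-suc w m k = trans (∑ℕ-upTo-suc m (λ j → if suc k ≤ᵇ j then w j else 0))
  (∑ℕ-cong (upTo m) (λ j → cong (λ b → if b then w (suc j) else 0) (≤ᵇ-suc k j)))

suffixSum-step : ∀ w m k → k < m → suffixSum w m k ≡ w k + suffixSum w m (suc k)
suffixSum-step w (suc m) zero _ = trans (∑ℕ-upTo-suc m (λ j → if 0 ≤ᵇ j then w j else 0)) (cong (w 0 +_) (sym (suffixSum-suc w m 0)))
suffixSum-step w (suc m) (suc k) (s≤s lt) = trans (suffixSum-suc w m k)
  (trans (suffixSum-step (λ j → w (suc j)) m k lt) (cong (w (suc k) +_) (sym (suffixSum-suc w m (suc k)))))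

suffixSum-beyond : ∀ w m k → m ≤ k → suffixSum w m k ≡ 0
suffixSum-beyond w zero k _ = refl
suffixSum-beyond w (suc m) (suc k) (s≤s le) = trans (suffixSum-suc w m k) (suffixSum-beyond (λ j → w (suc j)) m k le)

suffixSum-suc-≤ : ∀ w m k → suffixSum w m (suc k) ≤ suffixSum w m k
suffixSum-suc-≤ w m k with k ℕ.<? m
... | yes lt = subst (suffixSum w m (suc k) ≤_) (sym (suffixSum-step w m k lt)) (ℕP.m≤n+m _ (w k))
... | no nlt = ℕP.≤-reflexive (trans (suffixSum-beyond w m (suc k) (ℕP.≤-trans (ℕP.≮⇒≥ nlt) (ℕP.n≤1+n k)))
  (sym (suffixSum-beyond w m k (ℕP.≮⇒≥ nlt))))

suffixSum-antitone : ∀ w m k d → suffixSum w m (k + d) ≤ suffixSum w m k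
suffixSum-antitone w m k zero = ℕP.≤-reflexive (cong (suffixSum w m) (ℕP.+-identityʳ k))
suffixSum-antitone w m k (suc d) = ℕP.≤-trans
  (subst (λ z → suffixSum w m z ≤ suffixSum w m (k + d)) (sym (ℕP.+-suc k d)) (suffixSum-suc-≤ w m (k + d)))
  (suffixSum-antitone w m k d)

prefix-member≡≤ᵇ : ∀ P n → distinct P ≡ true → L.length P ≡ n → ∀ k j → k < n → j < n →
  any (λ t → nth P t ≡ᵇ nth P k) (upTo (suc j)) ≡ (k ≤ᵇ j)
prefix-member≡≤ᵇ P n d len k j k<n j<n with k ℕ.≤? j
... | yes k≤j = trans (any≡true⇐ _ (upTo (suc j)) (AnyP.applyUpTo⁺ id {i = k} (≡ᵇ-refl (nth P k)) (s≤s k≤j))) (sym (≤⇒≤ᵇ≡true k≤j))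
... | no k≰j = trans (¬T⇒≡ (notMember ∘ T⇒≡)) (sym (≰⇒≤ᵇ≡false k≰j))
  where
  notMember : any (λ t → nth P t ≡ᵇ nth P k) (upTo (suc j)) ≢ true
  notMember e with AnyP.applyUpTo⁻ id (any≡true⇒ _ (upTo (suc j)) e)
  ... | t , t<1+j , Pt≡Pk = k≰j (subst (_≤ j) t≡k (ℕP.≤-pred t<1+j))
    where
    t≡k = distinct⇒nth-injective P d t k (subst (t <_) (sym len) (ℕP.≤-<-trans (ℕP.≤-pred t<1+j) j<n))
                                         (subst (k <_) (sym len) k<n) (≡ᵇ≡true⇒≡ Pt≡Pk)

-- key orders the indices i < n by decreasing ev i, and equal values by increasing i.
module SortKey (n B : ℕ) (ev : ℕ → ℕ) (evB : ∀ i → ev i ≤ B) where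
  key : ℕ → ℕ
  key i = i + (B ∸ ev i) * n

  key-<-lex : ∀ i j q q' → i < n → q < q' → i + q * n < j + q' * n
  key-<-lex i j q q' i<n q<q' = ℕP.<-≤-trans (ℕP.+-monoˡ-< (q * n) i<n) (ℕP.≤-trans (ℕP.*-monoˡ-≤ n q<q') (ℕP.m≤n+m (q' * n) j))

  key-injective : ∀ i j → i < n → j < n → key i ≡ key j → i ≡ j
  key-injective i j i<n j<n eq with ℕP.<-cmp (B ∸ ev i) (B ∸ ev j)
  ... | tri< lt _ _ = ⊥-elim (ℕP.<-irrefl eq (key-<-lex i j _ _ i<n lt))
  ... | tri> _ _ gt = ⊥-elim (ℕP.<-irrefl (sym eq) (key-<-lex j i _ _ j<n gt))
  ... | tri≈ _ qe _ = ℕP.+-cancelʳ-≡ _ i j (trans eq (cong (λ z → j + z * n) (sym qe)))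

  key-<-of-ev-> : ∀ i j → i < n → ev j < ev i → key i < key j
  key-<-of-ev-> i j i<n lt = key-<-lex i j _ _ i<n (ℕP.∸-monoʳ-< lt (evB i))

  key-<-of-ev-≡ : ∀ i j → ev i ≡ ev j → i < j → key i < key j
  key-<-of-ev-≡ i j eq lt rewrite eq = ℕP.+-monoˡ-< _ lt

  key-<⇒ev-≥ : ∀ i j → j < n → key i < key j → ev j ≤ ev i
  key-<⇒ev-≥ i j j<n lt with ev j ℕ.≤? ev i
  ... | yes le = le
  ... | no nle = ⊥-elim (ℕP.<-asym lt (key-<-of-ev-> j i j<n (ℕP.≰⇒> nle)))

  key-<∧ev-≡⇒< : ∀ i j → key i < key j → ev i ≡ ev j → i < j
  key-<∧ev-≡⇒< i j lt eq rewrite eq = ℕP.+-cancelʳ-< _ i j lt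

All-upTo : ∀ {P : ℕ → Set} n → (∀ j → j < n → P j) → All P (upTo n)
All-upTo n h = AllP.applyUpTo⁺₁ id n (λ {i} lt → h i lt)

nth-toList : ∀ {m} (v : Vec ℕ m) (i : Fin m) → nth (V.toList v) (toℕ i) ≡ V.lookup v i
nth-toList (x ∷ v) F.zero = refl
nth-toList (x ∷ v) (F.suc i) = nth-toList v i

nth≤sum : ∀ {m} (v : Vec ℕ m) i → nth (V.toList v) i ≤ V.sum v
nth≤sum [] i = z≤n
nth≤sum (x ∷ v) zero = ℕP.m≤m+n x _
nth≤sum (x ∷ v) (suc i) = ℕP.≤-trans (nth≤sum v i) (ℕP.m≤n+m _ x)

nth-tail≤sum : ∀ {n} (v : Vec ℕ (suc n)) i → nth (V.toList (V.tail v)) i ≤ V.sum v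
nth-tail≤sum (x ∷ v) i = ℕP.≤-trans (nth≤sum v i) (ℕP.m≤n+m _ x)

nth-map-upTo : ∀ (f : ℕ → ℕ) n k → k < n → nth (map f (upTo n)) k ≡ f k
nth-map-upTo f (suc n) zero _ = refl
nth-map-upTo f (suc n) (suc k) (s≤s lt) = begin
    nth (map f (applyUpTo suc n)) k
  ≡⟨ cong (λ l → nth (map f l) k) (sym (LP.map-upTo suc n)) ⟩
    nth (map f (map suc (upTo n))) k
  ≡⟨ cong (λ l → nth l k) (sym (LP.map-∘ (upTo n))) ⟩
    nth (map (f ∘ suc) (upTo n)) k
  ≡⟨ nth-map-upTo (f ∘ suc) n k lt ⟩
    f (suc k) ∎
  where open ≡-Reasoning

vecOf-nth : ∀ n as bs → vecOf n as ≡ vecOf n bs → ∀ k → k < n → nth as k ≡ nth bs k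
vecOf-nth (suc n) as bs eq zero _ = trans (nth-hd as) (trans (proj₁ (VP.∷-injective eq)) (sym (nth-hd bs)))
vecOf-nth (suc n) as bs eq (suc k) (s≤s lt) =
  trans (nth-tl as k) (trans (vecOf-nth n (tl as) (tl bs) (proj₂ (VP.∷-injective eq)) k lt) (sym (nth-tl bs k)))

vecOf-ext : ∀ n as bs → (∀ k → k < n → nth as k ≡ nth bs k) → vecOf n as ≡ vecOf n bs
vecOf-ext zero as bs h = refl
vecOf-ext (suc n) as bs h = cong₂ _∷_ (trans (sym (nth-hd as)) (trans (h 0 (s≤s z≤n)) (nth-hd bs)))
  (vecOf-ext n (tl as) (tl bs) (λ k lt → trans (sym (nth-tl as k)) (trans (h (suc k) (s≤s lt)) (nth-tl bs k))))

lookup-vecOf : ∀ n as (i : Fin n) → V.lookup (vecOf n as) i ≡ nth as (toℕ i)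
lookup-vecOf (suc n) as F.zero = sym (nth-hd as)
lookup-vecOf (suc n) as (F.suc i) = trans (lookup-vecOf n (tl as) i) (sym (nth-tl as (toℕ i)))

VAll-tabulate : ∀ {P : ℕ → Set} {m} (v : Vec ℕ m) → (∀ i → P (V.lookup v i)) → VAll P v
VAll-tabulate [] h = VA.[]
VAll-tabulate (x ∷ v) h = h F.zero VA.∷ VAll-tabulate v (λ i → h (F.suc i))

VAll-lookup : ∀ {P : ℕ → Set} {m} (v : Vec ℕ m) → VAll P v → ∀ i → P (V.lookup v i)
VAll-lookup (x ∷ v) (p VA.∷ ps) F.zero = p
VAll-lookup (x ∷ v) (p VA.∷ ps) (F.suc i) = VAll-lookup v ps i

lookup-extensionality : ∀ {m} (u v : Vec ℕ m) → (∀ i → V.lookup u i ≡ V.lookup v i) → u ≡ v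
lookup-extensionality [] [] h = refl
lookup-extensionality (x ∷ u) (y ∷ v) h = cong₂ _∷_ (h F.zero) (lookup-extensionality u v (λ i → h (F.suc i)))

lookup-suc-tail : ∀ {n} (v : Vec ℕ (suc n)) (i : Fin n) → V.lookup v (F.suc i) ≡ nth (V.toList (V.tail v)) (toℕ i)
lookup-suc-tail (x ∷ v) i = sym (nth-toList v i)

lookup-zero-head : ∀ {n} (v : Vec ℕ (suc n)) → V.lookup v F.zero ≡ V.head v
lookup-zero-head (x ∷ v) = refl

toℕs-< : ∀ {m n} (v : Vec (Fin m) n) → All (_< m) (toℕs v)
toℕs-< [] = []
toℕs-< (x ∷ v) = FP.toℕ<n x ∷ toℕs-< v

*-if-1-0 : ∀ w b → w * (if b then 1 else 0) ≡ (if b then w else 0)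
*-if-1-0 w true = ℕP.*-identityʳ w
*-if-1-0 w false = ℕP.*-zeroʳ w

module _ (r : ℕ) .{{_ : NonZero r}} where

  [a+q*r]/r≡q : ∀ a q → a < r → (a + q * r) / r ≡ q
  [a+q*r]/r≡q a q a<r = begin
      (a + q * r) / r
    ≡⟨ +-distrib-/ a (q * r) (subst (_< r) (sym (trans (cong₂ _+_ (m<n⇒m%n≡m a<r) (m*n%n≡0 q r)) (ℕP.+-identityʳ a))) a<r) ⟩
      a / r + q * r / r
    ≡⟨ cong₂ _+_ (m<n⇒m/n≡0 a<r) (m*n/n≡m q r) ⟩
      q ∎
    where open ≡-Reasoning

  divMod-split : ∀ d (b : Bool) → (b ≡ true → d % r ≡ 0 × 0 < d) →
    (if b then r else 0) + d % r + r * (d / r ∸ (if b then 1 else 0)) ≡ d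
  divMod-split d false _ = trans (cong (d % r +_) (ℕP.*-comm r (d / r))) (sym (m≡m%n+[m/n]*n d r))
  divMod-split d true divides with divides refl
  ... | rem≡0 , d>0 = begin
      r + d % r + r * (d / r ∸ 1)
    ≡⟨ cong (λ z → r + z + r * (d / r ∸ 1)) rem≡0 ⟩
      r + 0 + r * (d / r ∸ 1)
    ≡⟨ cong (_+ r * (d / r ∸ 1)) (ℕP.+-identityʳ r) ⟩
      r + r * (d / r ∸ 1)
    ≡⟨ sym (ℕP.*-suc r (d / r ∸ 1)) ⟩
      r * (1 + (d / r ∸ 1))
    ≡⟨ cong (r *_) (ℕP.m+[n∸m]≡n quotient>0) ⟩
      r * (d / r)
    ≡⟨ trans (ℕP.*-comm r (d / r)) (sym d≡q*r) ⟩
      d ∎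
    where
    open ≡-Reasoning
    d≡q*r : d ≡ d / r * r
    d≡q*r = trans (m≡m%n+[m/n]*n d r) (cong (_+ d / r * r) rem≡0)
    quotient>0 : 0 < d / r
    quotient>0 = ℕP.n≢0⇒n>0 (λ q≡0 → ℕP.<⇒≢ d>0 (sym (trans d≡q*r (cong (_* r) q≡0))))

_≟L_ : (a b : List ℕ) → Dec (a ≡ b)
_≟L_ = LP.≡-dec ℕ._≟_

-- The data (π, c, t, s) from which e would arise; DecodeTerm shows they are forced
-- and EncodeTerm that they work whenever e lies in the cone.
module Canonical (r n : ℕ) (r>0 : 0 < r) (e : Exp (suc n)) where
  open ColourChanges r r>0 public

  S : ℕ
  S = V.sum e

  e₀ : ℕ
  e₀ = V.head e

  ev : ℕ → ℕ
  ev i = nth (V.toList (V.tail e)) i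

  ev≤S : ∀ i → ev i ≤ S
  ev≤S i = nth-tail≤sum e i

  open SortKey n S ev ev≤S public
  open InsertionSort key public

  πs : List ℕ
  πs = sort (upTo n)

  sortedExp : ℕ → ℕ
  sortedExp k = if k <ᵇ n then ev (nth πs k) else 0

  gap : ℕ → ℕ
  gap k = sortedExp k ∸ sortedExp (suc k)

  change : ℕ → ℕ
  change k = gap k % r

  isDescentAt : List ℕ → ℕ → Bool
  isDescentAt P j = (suc j <ᵇ n) ∧ (nth P (suc j) <ᵇ nth P j)

  extraDescent : ℕ → Bool
  extraDescent k = isDescentAt πs k ∧ (change k ≡ᵇ 0)

  δ : ℕ → ℕ
  δ k = if extraDescent k then 1 else 0

  period : ℕ → ℕ
  period k = gap k / r ∸ δ k

  t₀ : ℕ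
  t₀ = e₀ ∸ sortedExp 0

  changes : List ℕ
  changes = map change (upTo n)

  colours : List ℕ
  colours = coloursOf changes

  periods : List ℕ
  periods = map period (upTo n)

  changes-length : L.length changes ≡ n
  changes-length = trans (LP.length-map change (upTo n)) (LP.length-upTo n)

  πs-length : L.length πs ≡ n
  πs-length = trans (sort-length (upTo n)) (LP.length-upTo n)

  πs-∈ : ∀ {i} → i ∈ πs → i < n
  πs-∈ m = MP.∈-upTo⁻ (sort-∈⁻ (upTo n) m)

  πs-< : ∀ k → k < n → nth πs k < n
  πs-< k lt = πs-∈ (nth-∈ πs k (subst (k <_) (sym πs-length) lt))

  πs-sorted : Sorted πs
  πs-sorted = sort-sorted (upTo n) (UP.upTo⁺ n) (λ ma mb → key-injective _ _ (MP.∈-upTo⁻ ma) (MP.∈-upTo⁻ mb))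

  πs-increasing : IncreasingBelow n (λ k → key (nth πs k))
  πs-increasing k lt = sorted-nth-< πs πs-sorted k (subst (suc k <_) (sym πs-length) lt)

  πs-distinct : distinct πs ≡ true
  πs-distinct = nth-injective⇒distinct πs (λ j k j< k< eq →
    increasing⇒injective πs-increasing j k (subst (j <_) πs-length j<) (subst (k <_) πs-length k<) (cong key eq))

  πs-surjective : ∀ i → i < n → Σ ℕ (λ k → k < n × nth πs k ≡ i)
  πs-surjective i lt with ∈-nth πs (sort-∈⁺ (upTo n) (MP.∈-upTo⁺ lt))
  ... | k , k< , eq = k , subst (k <_) πs-length k< , eq

  sortedExp-< : ∀ k → k < n → sortedExp k ≡ ev (nth πs k)
  sortedExp-< k lt rewrite <⇒<ᵇ≡true lt = refl

  sortedExp-beyond : ∀ k → n ≤ k → sortedExp k ≡ 0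
  sortedExp-beyond k le rewrite ≮⇒<ᵇ≡false (ℕP.≤⇒≯ le) = refl

  sortedExp-antitone : ∀ k → sortedExp (suc k) ≤ sortedExp k
  sortedExp-antitone k with suc k ℕ.<? n
  ... | yes lt rewrite sortedExp-< (suc k) lt | sortedExp-< k (ℕP.<-trans (ℕP.n<1+n k) lt) =
    key-<⇒ev-≥ _ _ (πs-< (suc k) lt) (πs-increasing k lt)
  ... | no nlt rewrite sortedExp-beyond (suc k) (ℕP.≮⇒≥ nlt) = z≤n

  descent⇒sortedExp-< : ∀ k → suc k < n → nth πs (suc k) < nth πs k → sortedExp (suc k) < sortedExp k
  descent⇒sortedExp-< k lt descent rewrite sortedExp-< (suc k) lt | sortedExp-< k (ℕP.<-trans (ℕP.n<1+n k) lt)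
    with ℕP.m≤n⇒m<n∨m≡n (key-<⇒ev-≥ _ _ (πs-< (suc k) lt) (πs-increasing k lt))
  ... | inj₁ p = p
  ... | inj₂ p = ⊥-elim (ℕP.<-asym descent (key-<∧ev-≡⇒< _ _ (πs-increasing k lt) (sym p)))

  sortedExp≤S : ∀ k → sortedExp k ≤ S
  sortedExp≤S k with k ℕ.<? n
  ... | yes lt rewrite sortedExp-< k lt = ev≤S _
  ... | no nlt rewrite sortedExp-beyond k (ℕP.≮⇒≥ nlt) = z≤n

  period≤S : ∀ k → period k ≤ S
  period≤S k = ℕP.≤-trans (ℕP.m∸n≤m _ (δ k)) (ℕP.≤-trans (m/n≤m (gap k) r)
                 (ℕP.≤-trans (ℕP.m∸n≤m (sortedExp k) (sortedExp (suc k))) (sortedExp≤S k)))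

  -- X k is the exponent of z_{π(k+1)} in termExp t ts, the sum of the weights of M_k, M_{k+1}, ….
  module TermCoordinates (π : Vec (Fin n) n) (c : Vec (Fin r) n) (dπ : distinct (toℕs π) ≡ true) (t : ℕ) (ts : List ℕ) where
    open WreathExpansion r n r>0 π c S public
    open WreathCoordinates r n r>0 π c S public

    P : List ℕ
    P = toℕs π

    Wf : ℕ → ℕ
    Wf = weight ts

    X : ℕ → ℕ
    X k = suffixSum Wf n k

    P-length : L.length P ≡ n
    P-length = toℕs-length π

    lookup-termExp-suc : ∀ k → k < n → (i : Fin n) → toℕ i ≡ nth P k → V.lookup (termExp t ts) (F.suc i) ≡ X k
    lookup-termExp-suc k k<n i i≡Pk = begin
        V.lookup (termExp t ts) (F.suc i)
      ≡⟨ lookup-termExp t ts (F.suc i) ⟩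
        t * V.lookup u0 (F.suc i) + ∑ℕ (upTo n) (λ j → Wf j * V.lookup (Mj j) (F.suc i))
      ≡⟨ cong (_+ ∑ℕ (upTo n) (λ j → Wf j * V.lookup (Mj j) (F.suc i)))
              (trans (cong (t *_) (VP.lookup∘tabulate (λ (q : Fin (suc n)) → if does (q F.≟ F.zero) then 1 else 0) (F.suc i))) (ℕP.*-zeroʳ t)) ⟩
        ∑ℕ (upTo n) (λ j → Wf j * V.lookup (Mj j) (F.suc i))
      ≡⟨ ∑ℕ-cong-All (All-upTo n (λ j j<n → cong (Wf j *_) (trans (VP.lookup∘tabulate _ i) (M-coefficient j j<n)))) ⟩
        ∑ℕ (upTo n) (λ j → Wf j * (if k ≤ᵇ j then 1 else 0))
      ≡⟨ ∑ℕ-cong (upTo n) (λ j → *-if-1-0 (Wf j) (k ≤ᵇ j)) ⟩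
        X k ∎
      where
      open ≡-Reasoning
      M-coefficient : ∀ j → j < n → (if any (λ t → nth P t ≡ᵇ toℕ i) (upTo (suc j)) then 1 else 0) ≡ (if k ≤ᵇ j then 1 else 0)
      M-coefficient j j<n = cong (λ b → if b then 1 else 0)
        (trans (cong (λ z → any (λ t → nth P t ≡ᵇ z) (upTo (suc j))) i≡Pk) (prefix-member≡≤ᵇ P n dπ P-length k j k<n j<n))

    lookup-termExp-zero : V.lookup (termExp t ts) F.zero ≡ t + X 0
    lookup-termExp-zero = trans (lookup-termExp t ts F.zero)
      (cong₂ _+_ (ℕP.*-identityʳ t) (∑ℕ-cong (upTo n) (λ j → ℕP.*-identityʳ (Wf j))))

    X-step : ∀ k → k < n → X k ≡ Wf k + X (suc k)
    X-step k = suffixSum-step Wf n k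

  module DecodeTerm (π : Vec (Fin n) n) (c : Vec (Fin r) n) (dπ : distinct (toℕs π) ≡ true) (t : ℕ) (ts : List ℕ)
                    (termExp≡e : WreathExpansion.termExp r n r>0 π c S t ts ≡ e) where
    open TermCoordinates π c dπ t ts

    ev≡X : ∀ k → k < n → ev (nth P k) ≡ X k
    ev≡X k k<n = begin
        ev (nth P k)
      ≡⟨ cong ev (sym (FP.toℕ-fromℕ< Pk<n)) ⟩
        ev (toℕ i)
      ≡⟨ sym (lookup-suc-tail e i) ⟩
        V.lookup e (F.suc i)
      ≡⟨ cong (λ v → V.lookup v (F.suc i)) (sym termExp≡e) ⟩
        V.lookup (termExp t ts) (F.suc i)
      ≡⟨ lookup-termExp-suc k k<n i (FP.toℕ-fromℕ< Pk<n) ⟩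
        X k ∎
      where
      open ≡-Reasoning
      Pk<n = nth-toℕs-< π k k<n
      i = F.fromℕ< Pk<n

    e₀≡t+X0 : e₀ ≡ t + X 0
    e₀≡t+X0 = trans (sym (lookup-zero-head e)) (trans (cong (λ v → V.lookup v F.zero) (sym termExp≡e)) lookup-termExp-zero)

    P-surjective : ∀ i → i < n → Σ ℕ (λ k → k < n × nth P k ≡ i)
    P-surjective = PermutationSurjective.nth-surjective π dπ

    P-< : ∀ k → k < n → nth P k < n
    P-< k = nth-toℕs-< π k

    weight-pos-at-descent : ∀ k → suc k < n → nth P (suc k) < nth P k → 0 < Wf k
    weight-pos-at-descent k lt descent with a r n π c k ℕ.≟ 0
    ... | yes a≡0 = ℕP.<-≤-trans r>0 (ℕP.≤-trans (ℕP.≤-reflexive (sym descentWeight≡r))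
                      (ℕP.≤-trans (ℕP.m≤m+n (descentWeight k) (a r n π c k)) (ℕP.m≤m+n _ (r * nth ts k))))
      where
      descentWeight≡r : descentWeight k ≡ r
      descentWeight≡r rewrite <⇒<ᵇ≡true lt | <⇒<ᵇ≡true descent | a≡0 = refl
    ... | no a≢0 = ℕP.<-≤-trans (ℕP.n≢0⇒n>0 a≢0) (ℕP.≤-trans (ℕP.m≤n+m (a r n π c k) (descentWeight k)) (ℕP.m≤m+n _ (r * nth ts k)))

    -- A zero weight forces equal exponents, and then the absence of a descent puts P in key order.
    P-increasing : IncreasingBelow n (λ k → key (nth P k))
    P-increasing k lt with Wf k ℕ.≟ 0
    ... | no Wk≢0 = key-<-of-ev-> (nth P k) (nth P (suc k)) (P-< k k<n) (subst (ev (nth P (suc k)) <_) (sym evPk≡) (ℕP.m<n+m _ (ℕP.n≢0⇒n>0 Wk≢0)))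
      where
      k<n = ℕP.<-trans (ℕP.n<1+n k) lt
      evPk≡ : ev (nth P k) ≡ Wf k + ev (nth P (suc k))
      evPk≡ = trans (ev≡X k k<n) (trans (X-step k k<n) (cong (Wf k +_) (sym (ev≡X (suc k) lt))))
    ... | yes Wk≡0 with nth P (suc k) ℕ.<? nth P k
    ...   | yes descent = ⊥-elim (ℕP.<-irrefl (sym Wk≡0) (weight-pos-at-descent k lt descent))
    ...   | no ascent = key-<-of-ev-≡ (nth P k) (nth P (suc k)) evPk≡ (ℕP.≤∧≢⇒< (ℕP.≮⇒≥ ascent) Pk≢Pk+1)
      where
      k<n = ℕP.<-trans (ℕP.n<1+n k) lt
      evPk≡ : ev (nth P k) ≡ ev (nth P (suc k))
      evPk≡ = trans (ev≡X k k<n) (trans (X-step k k<n) (trans (cong (_+ X (suc k)) Wk≡0) (sym (ev≡X (suc k) lt))))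
      Pk≢Pk+1 : nth P k ≢ nth P (suc k)
      Pk≢Pk+1 eq = ℕP.1+n≢n (sym (distinct⇒nth-injective P dπ k (suc k) (subst (k <_) (sym P-length) k<n) (subst (suc k <_) (sym P-length) lt) eq))

    P≡πs : P ≡ πs
    P≡πs = nth-ext P πs (trans P-length (sym πs-length)) (λ k lt → agree k (subst (k <_) P-length lt))
      where
      P⊆πs : ∀ j → j < n → Σ ℕ (λ k → k < n × key (nth P j) ≡ key (nth πs k))
      P⊆πs j j<n with πs-surjective (nth P j) (P-< j j<n)
      ... | k , k< , eq = k , k< , cong key (sym eq)
      πs⊆P : ∀ j → j < n → Σ ℕ (λ k → k < n × key (nth πs j) ≡ key (nth P k))
      πs⊆P j j<n with P-surjective (nth πs j) (πs-< j j<n)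
      ... | k , k< , eq = k , k< , cong key (sym eq)
      agree : ∀ k → k < n → nth P k ≡ nth πs k
      agree k k<n = key-injective _ _ (P-< k k<n) (πs-< k k<n)
        (IncreasingSameImage.increasing-same-image n _ _ P-increasing πs-increasing P⊆πs πs⊆P k k<n)

    X≡sortedExp : ∀ k → X k ≡ sortedExp k
    X≡sortedExp k with k ℕ.<? n
    ... | yes lt = trans (sym (ev≡X k lt)) (trans (cong (λ Q → ev (nth Q k)) P≡πs) (sym (sortedExp-< k lt)))
    ... | no nlt = trans (suffixSum-beyond Wf n k (ℕP.≮⇒≥ nlt)) (sym (sortedExp-beyond k (ℕP.≮⇒≥ nlt)))

    weight≡gap : ∀ k → k < n → Wf k ≡ gap k
    weight≡gap k lt = begin
        Wf k
      ≡⟨ sym (ℕP.m+n∸n≡m (Wf k) (X (suc k))) ⟩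
        Wf k + X (suc k) ∸ X (suc k)
      ≡⟨ cong (_∸ X (suc k)) (sym (X-step k lt)) ⟩
        X k ∸ X (suc k)
      ≡⟨ cong₂ _∸_ (X≡sortedExp k) (X≡sortedExp (suc k)) ⟩
        gap k ∎
      where open ≡-Reasoning

    colour-< : ∀ j → j ≤ n → nth (toℕs c) j < r
    colour-< j le with ℕP.m≤n⇒m<n∨m≡n le
    ... | inj₁ lt = nth-toℕs-< c j lt
    ... | inj₂ refl = subst (_< r) (sym (nth-beyond (toℕs c) j (ℕP.≤-reflexive (toℕs-length c)))) r>0

    a-< : ∀ k → k < n → a r n π c k < r
    a-< k lt = modDiff<r _ _ (colour-< k (ℕP.<⇒≤ lt)) (colour-< (suc k) lt)

    δv : ℕ → ℕ
    δv k = if isDes r n π c k ∧ (a r n π c k ≡ᵇ 0) then 1 else 0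

    weight-divMod : ∀ k → Wf k ≡ a r n π c k + (δv k + nth ts k) * r
    weight-divMod k with isDes r n π c k ∧ (a r n π c k ≡ᵇ 0)
    ... | true = withDescent r (a r n π c k) (nth ts k)
      where
      withDescent : ∀ r a s → r + a + r * s ≡ a + (1 + s) * r
      withDescent = solve-∀
    ... | false = withoutDescent r (a r n π c k) (nth ts k)
      where
      withoutDescent : ∀ r a s → 0 + a + r * s ≡ a + (0 + s) * r
      withoutDescent = solve-∀

    a≡change : ∀ k → k < n → a r n π c k ≡ change k
    a≡change k lt = sym (begin
        gap k % r
      ≡⟨ cong (_% r) (trans (sym (weight≡gap k lt)) (weight-divMod k)) ⟩
        (a r n π c k + (δv k + nth ts k) * r) % r
      ≡⟨ [m+kn]%n≡m%n (a r n π c k) (δv k + nth ts k) r ⟩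
        a r n π c k % r
      ≡⟨ m<n⇒m%n≡m (a-< k lt) ⟩
        a r n π c k ∎)
      where open ≡-Reasoning

    c≡colours : toℕs c ≡ colours
    c≡colours = coloursOf-unique (toℕs c) changes (trans (toℕs-length c) (sym changes-length)) (toℕs-< c)
      (λ j lt → trans (a≡change j (subst (j <_) changes-length lt)) (sym (nth-map-upTo change n j (subst (j <_) changes-length lt))))

    δv≡δ : ∀ k → k < n → δv k ≡ δ k
    δv≡δ k lt = cong (λ b → if b then 1 else 0) (cong₂ (λ Q z → isDescentAt Q k ∧ (z ≡ᵇ 0)) P≡πs (a≡change k lt))

    s≡period : ∀ k → k < n → nth ts k ≡ period k
    s≡period k lt = sym (begin
        gap k / r ∸ δ k
      ≡⟨ cong (λ z → z / r ∸ δ k) gap≡ ⟩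
        (change k + (δ k + nth ts k) * r) / r ∸ δ k
      ≡⟨ cong (_∸ δ k) ([a+q*r]/r≡q r (change k) (δ k + nth ts k) (subst (_< r) (a≡change k lt) (a-< k lt))) ⟩
        δ k + nth ts k ∸ δ k
      ≡⟨ ℕP.m+n∸m≡n (δ k) (nth ts k) ⟩
        nth ts k ∎)
      where
      open ≡-Reasoning
      gap≡ : gap k ≡ change k + (δ k + nth ts k) * r
      gap≡ = trans (sym (weight≡gap k lt)) (trans (weight-divMod k) (cong₂ (λ x y → x + (y + nth ts k) * r) (a≡change k lt) (δv≡δ k lt)))

    t≡t₀ : t ≡ t₀
    t≡t₀ = sym (trans (cong₂ _∸_ e₀≡t+X0 (sym (X≡sortedExp 0))) (ℕP.m+n∸n≡m t (X 0)))

    inCone : InCone e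
    inCone = VAll-tabulate (V.tail e) (λ i → subst (_< suc e₀) (nth-toList (V.tail e) i) (ev≤e₀ (toℕ i) (FP.toℕ<n i)))
      where
      ev≤e₀ : ∀ i → i < n → ev i < suc e₀
      ev≤e₀ i lt with P-surjective i lt
      ... | k , k< , Pk≡i = s≤s (subst (_≤ e₀) (trans (sym (ev≡X k k<)) (cong ev Pk≡i))
                                  (ℕP.≤-trans (suffixSum-antitone Wf n 0 k) (subst (X 0 ≤_) (sym e₀≡t+X0) (ℕP.m≤n+m (X 0) t))))

  module EncodeTerm (π : Vec (Fin n) n) (c : Vec (Fin r) n) (t : ℕ) (ts : List ℕ)
                    (π≡πs : toℕs π ≡ πs) (c≡colours : toℕs c ≡ colours) (t≡t₀ : t ≡ t₀)
                    (ts≡periods : vecOf n ts ≡ vecOf n periods) (inCone : InCone e) where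
    dπ : distinct (toℕs π) ≡ true
    dπ = subst (λ Q → distinct Q ≡ true) (sym π≡πs) πs-distinct

    open TermCoordinates π c dπ t ts

    s≡period : ∀ k → k < n → nth ts k ≡ period k
    s≡period k lt = trans (vecOf-nth n ts periods ts≡periods k lt) (nth-map-upTo period n k lt)

    changes-< : All (_< r) changes
    changes-< = AllP.map⁺ (All-upTo n (λ j _ → m%n<n (gap j) r))

    a≡change : ∀ k → k < n → a r n π c k ≡ change k
    a≡change k lt = trans (cong (λ Q → modDiff (nth Q k) (nth Q (suc k))) c≡colours)
      (trans (coloursOf-changes changes k changes-< (subst (k <_) (sym changes-length) lt)) (nth-map-upTo change n k lt))

    weight≡gap : ∀ k → k < n → Wf k ≡ gap k
    weight≡gap k lt = begin
        Wf k
      ≡⟨ cong₂ (λ b s → (if b then r else 0) + a r n π c k + r * s)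
               (cong₂ (λ Q z → isDescentAt Q k ∧ (z ≡ᵇ 0)) π≡πs (a≡change k lt)) (s≡period k lt) ⟩
        (if extraDescent k then r else 0) + a r n π c k + r * period k
      ≡⟨ cong (λ z → (if extraDescent k then r else 0) + z + r * period k) (a≡change k lt) ⟩
        (if extraDescent k then r else 0) + gap k % r + r * (gap k / r ∸ δ k)
      ≡⟨ divMod-split r (gap k) (extraDescent k) extraDescent⇒ ⟩
        gap k ∎
      where
      open ≡-Reasoning
      extraDescent⇒ : extraDescent k ≡ true → gap k % r ≡ 0 × 0 < gap k
      extraDescent⇒ eq with ∧-true eq
      ... | isDescent , change≡0 with ∧-true isDescent
      ...   | k+1<n , descent = ≡ᵇ≡true⇒≡ change≡0 , ℕP.m<n⇒0<n∸m (descent⇒sortedExp-< k (<ᵇ≡true⇒< k+1<n) (<ᵇ≡true⇒< descent))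

    X≡sortedExp-from : ∀ d k → k + d ≡ n → X k ≡ sortedExp k
    X≡sortedExp-from zero k k≡n = trans (suffixSum-beyond Wf n k n≤k) (sym (sortedExp-beyond k n≤k))
      where n≤k = ℕP.≤-reflexive (trans (sym k≡n) (ℕP.+-identityʳ k))
    X≡sortedExp-from (suc d) k k+d+1≡n = begin
        X k
      ≡⟨ X-step k k<n ⟩
        Wf k + X (suc k)
      ≡⟨ cong₂ _+_ (weight≡gap k k<n) (X≡sortedExp-from d (suc k) (trans (sym (ℕP.+-suc k d)) k+d+1≡n)) ⟩
        gap k + sortedExp (suc k)
      ≡⟨ ℕP.m∸n+n≡m (sortedExp-antitone k) ⟩
        sortedExp k ∎
      where
      open ≡-Reasoning
      k<n : k < n
      k<n = subst (k <_) k+d+1≡n (ℕP.≤-trans (s≤s (ℕP.m≤m+n k d)) (ℕP.≤-reflexive (sym (ℕP.+-suc k d))))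

    X≡sortedExp : ∀ k → X k ≡ sortedExp k
    X≡sortedExp k with k ℕ.≤? n
    ... | yes le = X≡sortedExp-from (n ∸ k) k (ℕP.m+[n∸m]≡n le)
    ... | no nle = trans (suffixSum-beyond Wf n k (ℕP.<⇒≤ (ℕP.≰⇒> nle))) (sym (sortedExp-beyond k (ℕP.<⇒≤ (ℕP.≰⇒> nle))))

    sortedExp0≤e₀ : sortedExp 0 ≤ e₀
    sortedExp0≤e₀ with 0 ℕ.<? n
    ... | no n≡0 = subst (_≤ e₀) (sym (sortedExp-beyond 0 (ℕP.≮⇒≥ n≡0))) z≤n
    ... | yes n>0 = subst (_≤ e₀) (sym (sortedExp-< 0 n>0))
        (ℕP.≤-pred (subst (_< suc e₀) (trans (sym (nth-toList (V.tail e) i)) (cong ev (FP.toℕ-fromℕ< (πs-< 0 n>0))))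
                                      (VAll-lookup (V.tail e) inCone i)))
      where
      i : Fin n
      i = F.fromℕ< (πs-< 0 n>0)

    termExp≡e : termExp t ts ≡ e
    termExp≡e = lookup-extensionality _ _ coordinate
      where
      coordinate : ∀ q → V.lookup (termExp t ts) q ≡ V.lookup e q
      coordinate F.zero = trans lookup-termExp-zero (trans (cong₂ _+_ t≡t₀ (X≡sortedExp 0))
                                 (trans (ℕP.m∸n+n≡m sortedExp0≤e₀) (sym (lookup-zero-head e))))
      coordinate (F.suc i) with πs-surjective (toℕ i) (FP.toℕ<n i)
      ... | k , k<n , πsk≡i = begin
          V.lookup (termExp t ts) (F.suc i)
        ≡⟨ lookup-termExp-suc k k<n i (sym (trans (cong (λ Q → nth Q k) π≡πs) πsk≡i)) ⟩
          X k
        ≡⟨ trans (X≡sortedExp k) (sortedExp-< k k<n) ⟩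
          ev (nth πs k)
        ≡⟨ trans (cong ev πsk≡i) (sym (lookup-suc-tail e i)) ⟩
          V.lookup e (F.suc i) ∎
        where open ≡-Reasoning

  𝟙-termExp≟e : ∀ π c t ts → distinct (toℕs π) ≡ true →
    𝟙 (WreathExpansion.termExp r n r>0 π c S t ts ≟v e)
      ≡ 𝟙 (inCone? e) ℤ.* 𝟙 (toℕs π ≟L πs) ℤ.* 𝟙 (toℕs c ≟L colours) ℤ.* (𝟙 (t ℕ.≟ t₀) ℤ.* 𝟙 (vecOf n ts ≟v vecOf n periods))
  𝟙-termExp≟e π c t ts dπ = begin
      𝟙 (WreathExpansion.termExp r n r>0 π c S t ts ≟v e)
    ≡⟨ 𝟙-cong _ canonical decode (λ { (cone , π≡ , c≡ , t≡ , ts≡) → EncodeTerm.termExp≡e π c t ts π≡ c≡ t≡ ts≡ cone }) ⟩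
      𝟙 canonical
    ≡⟨ trans (𝟙-× (inCone? e) _) (cong (𝟙 (inCone? e) ℤ.*_) (trans (𝟙-× (toℕs π ≟L πs) _)
         (cong (𝟙 (toℕs π ≟L πs) ℤ.*_) (trans (𝟙-× (toℕs c ≟L colours) _) (cong (𝟙 (toℕs c ≟L colours) ℤ.*_) (𝟙-× (t ℕ.≟ t₀) _)))))) ⟩
      𝟙 (inCone? e) ℤ.* (𝟙 (toℕs π ≟L πs) ℤ.* (𝟙 (toℕs c ≟L colours) ℤ.* (𝟙 (t ℕ.≟ t₀) ℤ.* 𝟙 (vecOf n ts ≟v vecOf n periods))))
    ≡⟨ trans (sym (ℤP.*-assoc (𝟙 (inCone? e)) (𝟙 (toℕs π ≟L πs)) _))
             (sym (ℤP.*-assoc (𝟙 (inCone? e) ℤ.* 𝟙 (toℕs π ≟L πs)) (𝟙 (toℕs c ≟L colours)) _)) ⟩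
      𝟙 (inCone? e) ℤ.* 𝟙 (toℕs π ≟L πs) ℤ.* 𝟙 (toℕs c ≟L colours) ℤ.* (𝟙 (t ℕ.≟ t₀) ℤ.* 𝟙 (vecOf n ts ≟v vecOf n periods)) ∎
    where
    open ≡-Reasoning
    canonical = inCone? e ×-dec ((toℕs π ≟L πs) ×-dec ((toℕs c ≟L colours) ×-dec ((t ℕ.≟ t₀) ×-dec (vecOf n ts ≟v vecOf n periods))))
    decode : _ → _
    decode eq = inCone , P≡πs , c≡colours , t≡t₀ , vecOf-ext n ts periods (λ k lt → trans (s≡period k lt) (sym (nth-map-upTo period n k lt)))
      where open DecodeTerm π c dπ t ts eq

𝟙-≟L-∷ : ∀ x y (xs ys : List ℕ) → 𝟙 ((x ∷ xs) ≟L (y ∷ ys)) ≡ 𝟙 (x ℕ.≟ y) ℤ.* 𝟙 (xs ≟L ys)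
𝟙-≟L-∷ x y xs ys = trans (𝟙-cong _ (x ℕ.≟ y ×-dec (xs ≟L ys)) (λ { refl → refl , refl }) (λ { (refl , refl) → refl }))
                         (𝟙-× (x ℕ.≟ y) (xs ≟L ys))

∑∑-*ˡ : ∀ (xs : List A) (ys : List B) a (h : A → B → ℤ) →
  ∑ xs (λ x → ∑ ys (λ y → a ℤ.* h x y)) ≡ a ℤ.* ∑ xs (λ x → ∑ ys (h x))
∑∑-*ˡ xs ys a h = trans (∑-cong xs (λ x → sym (∑-*ˡ ys a (h x)))) (sym (∑-*ˡ xs a _))

∑-product : ∀ (xs : List A) (ys : List B) f g → ∑ xs (λ x → ∑ ys (λ y → f x ℤ.* g y)) ≡ ∑ xs f ℤ.* ∑ ys g
∑-product xs ys f g = trans (∑-cong xs (λ x → sym (∑-*ˡ ys (f x) g))) (sym (∑-*ʳ xs (∑ ys g) f))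

∑-allFin : ∀ m (f : ℕ → ℤ) → ∑ (allFin m) (λ x → f (toℕ x)) ≡ ∑ (upTo m) f
∑-allFin zero f = refl
∑-allFin (suc m) f = cong (λ z → f 0 ℤ.+ z)
  (trans (cong (λ l → ∑ l (λ x → f (toℕ x))) (sym (LP.map-tabulate {n = m} id F.suc)))
  (trans (∑-map F.suc (allFin m) (λ x → f (toℕ x)))
  (trans (∑-allFin m (λ x → f (suc x)))
         (sym (trans (cong (λ l → ∑ l f) (sym (LP.map-upTo suc m))) (∑-map suc (upTo m) f))))))

∑-allVecs-𝟙≟-once : ∀ m n (Ls : List ℕ) → L.length Ls ≡ n → All (_< m) Ls → ∑ (allVecs m n) (λ v → 𝟙 (toℕs v ≟L Ls)) ≡ 1ℤ
∑-allVecs-𝟙≟-once m zero [] _ _ = refl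
∑-allVecs-𝟙≟-once m (suc n) (y ∷ Ls) len (y<m ∷ Ls<m) = begin
    ∑ (concatMap (λ x → map (x ∷_) (allVecs m n)) (allFin m)) h
  ≡⟨ ∑-concatMap _ (allFin m) h ⟩
    ∑ (allFin m) (λ x → ∑ (map (x ∷_) (allVecs m n)) h)
  ≡⟨ ∑-cong (allFin m) (λ x → ∑-map (x ∷_) (allVecs m n) h) ⟩
    ∑ (allFin m) (λ x → ∑ (allVecs m n) (λ v → 𝟙 ((toℕ x ∷ toℕs v) ≟L (y ∷ Ls))))
  ≡⟨ ∑-cong (allFin m) (λ x → ∑-cong (allVecs m n) (λ v → 𝟙-≟L-∷ (toℕ x) y (toℕs v) Ls)) ⟩
    ∑ (allFin m) (λ x → ∑ (allVecs m n) (λ v → 𝟙 (toℕ x ℕ.≟ y) ℤ.* 𝟙 (toℕs v ≟L Ls)))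
  ≡⟨ ∑-product (allFin m) (allVecs m n) (λ x → 𝟙 (toℕ x ℕ.≟ y)) (λ v → 𝟙 (toℕs v ≟L Ls)) ⟩
    ∑ (allFin m) (λ x → 𝟙 (toℕ x ℕ.≟ y)) ℤ.* ∑ (allVecs m n) (λ v → 𝟙 (toℕs v ≟L Ls))
  ≡⟨ cong₂ ℤ._*_ (trans (∑-allFin m (λ t → 𝟙 (t ℕ.≟ y))) (∑-upTo-𝟙≟-once m y y<m))
                 (∑-allVecs-𝟙≟-once m n Ls (ℕP.suc-injective len) Ls<m) ⟩
    1ℤ ∎
  where
  open ≡-Reasoning
  h = λ (v : Vec (Fin m) (suc n)) → 𝟙 (toℕs v ≟L (y ∷ Ls))

module CoefficientCount (r n : ℕ) (r>0 : 0 < r) (e : Exp (suc n)) where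
  open Canonical r n r>0 e

  U : List ℕ
  U = upTo (suc S)

  ∑-periods-once : ∑ (tuples U n) (λ ts → 𝟙 (vecOf n ts ≟v vecOf n periods)) ≡ 1ℤ
  ∑-periods-once = trans (∑-tuples-vecOf (suc S) n (vecOf n periods)) (𝟙-yes _ (VAll-tabulate (vecOf n periods) periods<))
    where
    periods< : ∀ i → V.lookup (vecOf n periods) i < suc S
    periods< i = subst (_< suc S) (sym (trans (lookup-vecOf n periods i) (nth-map-upTo period n (toℕ i) (FP.toℕ<n i))))
                       (s≤s (period≤S (toℕ i)))

  ∑-t₀-once : ∑ U (λ t → 𝟙 (t ℕ.≟ t₀)) ≡ 1ℤ
  ∑-t₀-once = ∑-upTo-𝟙≟-once (suc S) t₀ (s≤s (ℕP.≤-trans (ℕP.m∸n≤m e₀ (sortedExp 0)) (head≤sum e)))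

  ∑-colours-once : ∑ (allVecs r n) (λ c → 𝟙 (toℕs c ≟L colours)) ≡ 1ℤ
  ∑-colours-once = ∑-allVecs-𝟙≟-once r n colours (trans (coloursOf-length changes) changes-length) (coloursOf-< changes)

  ∑-perms-once : ∑ (allVecs n n) (λ π → 𝟙 (toℕs π ≟L πs)) ≡ 1ℤ
  ∑-perms-once = ∑-allVecs-𝟙≟-once n n πs πs-length (All.tabulate πs-∈)

  coeff : Vec (Fin n) n → Vec (Fin r) n → ℤ
  coeff π c = ∑ U (λ t → ∑ (tuples U n) (λ ts → 𝟙 (WreathExpansion.termExp r n r>0 π c S t ts ≟v e)))

  K : Vec (Fin n) n → ℤ
  K π = 𝟙 (inCone? e) ℤ.* 𝟙 (toℕs π ≟L πs)

  coeff-𝟙 : ∀ π c → distinct (toℕs π) ≡ true → coeff π c ≡ K π ℤ.* 𝟙 (toℕs c ≟L colours)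
  coeff-𝟙 π c dπ = begin
      coeff π c
    ≡⟨ ∑-cong U (λ t → ∑-cong (tuples U n) (λ ts → 𝟙-termExp≟e π c t ts dπ)) ⟩
      ∑ U (λ t → ∑ (tuples U n) (λ ts → K π ℤ.* 𝟙 (toℕs c ≟L colours) ℤ.* (𝟙 (t ℕ.≟ t₀) ℤ.* 𝟙 (vecOf n ts ≟v vecOf n periods))))
    ≡⟨ ∑∑-*ˡ U (tuples U n) (K π ℤ.* 𝟙 (toℕs c ≟L colours)) _ ⟩
      K π ℤ.* 𝟙 (toℕs c ≟L colours) ℤ.* ∑ U (λ t → ∑ (tuples U n) (λ ts → 𝟙 (t ℕ.≟ t₀) ℤ.* 𝟙 (vecOf n ts ≟v vecOf n periods)))
    ≡⟨ cong (K π ℤ.* 𝟙 (toℕs c ≟L colours) ℤ.*_)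
            (trans (∑-product U (tuples U n) (λ t → 𝟙 (t ℕ.≟ t₀)) (λ ts → 𝟙 (vecOf n ts ≟v vecOf n periods)))
                   (cong₂ ℤ._*_ ∑-t₀-once ∑-periods-once)) ⟩
      K π ℤ.* 𝟙 (toℕs c ≟L colours) ℤ.* 1ℤ
    ≡⟨ ℤP.*-identityʳ _ ⟩
      K π ℤ.* 𝟙 (toℕs c ≟L colours) ∎
    where open ≡-Reasoning

  ∑-colours-coeff : ∀ π → (if distinct (toℕs π) then ∑ (allVecs r n) (coeff π) else 0ℤ) ≡ K π
  ∑-colours-coeff π with distinct (toℕs π) in dπ
  ... | true = begin
      ∑ (allVecs r n) (coeff π)
    ≡⟨ ∑-cong (allVecs r n) (λ c → coeff-𝟙 π c dπ) ⟩
      ∑ (allVecs r n) (λ c → K π ℤ.* 𝟙 (toℕs c ≟L colours))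
    ≡⟨ sym (∑-*ˡ (allVecs r n) (K π) _) ⟩
      K π ℤ.* ∑ (allVecs r n) (λ c → 𝟙 (toℕs c ≟L colours))
    ≡⟨ trans (cong (K π ℤ.*_) ∑-colours-once) (ℤP.*-identityʳ _) ⟩
      K π ∎
    where open ≡-Reasoning
  ... | false = sym (trans (cong (𝟙 (inCone? e) ℤ.*_) (𝟙-no (toℕs π ≟L πs) π≢πs)) (ℤP.*-zeroʳ (𝟙 (inCone? e))))
    where
    π≢πs : toℕs π ≢ πs
    π≢πs eq = false≢true (trans (sym dπ) (subst (λ Q → distinct Q ≡ true) (sym eq) πs-distinct))

  rhs-coeff : rhs r n e ≡ 𝟙 (inCone? e)
  rhs-coeff = begin
      rhs r n e
    ≡⟨ rhs-coeff-expanded r n r>0 e ⟩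
      ∑ (wreath r n) (λ p → coeff (proj₁ p) (proj₂ p))
    ≡⟨ ∑-concatMap _ (perms n) _ ⟩
      ∑ (perms n) (λ π → ∑ (map (π ,_) (allVecs r n)) (λ p → coeff (proj₁ p) (proj₂ p)))
    ≡⟨ ∑-cong (perms n) (λ π → ∑-map (π ,_) (allVecs r n) _) ⟩
      ∑ (perms n) (λ π → ∑ (allVecs r n) (coeff π))
    ≡⟨ ∑-filterᵇ _ (allVecs n n) _ ⟩
      ∑ (allVecs n n) (λ π → if distinct (toℕs π) then ∑ (allVecs r n) (coeff π) else 0ℤ)
    ≡⟨ ∑-cong (allVecs n n) ∑-colours-coeff ⟩
      ∑ (allVecs n n) K
    ≡⟨ sym (∑-*ˡ (allVecs n n) (𝟙 (inCone? e)) _) ⟩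
      𝟙 (inCone? e) ℤ.* ∑ (allVecs n n) (λ π → 𝟙 (toℕs π ≟L πs))
    ≡⟨ trans (cong (𝟙 (inCone? e) ℤ.*_) ∑-perms-once) (ℤP.*-identityʳ _) ⟩
      𝟙 (inCone? e) ∎
    where open ≡-Reasoning

theorem5p15 : (r n : ℕ) → 0 < r → 0 < n →
    (e : Exp (suc n)) → lhs n e ≡ rhs r n e
theorem5p15 r n r>0 _ e = trans (lhs-coeff n e) (sym (CoefficientCount.rhs-coeff r n r>0 e))
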